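{- There is a constant $k_0>0$ such that for all integers $k\geq k_0$ and all $m$ with $m/n\leq 2^k\ln 2$, the uniformly random $k$-CNF $\Phi$ with $m$ clauses over $n$ variables has the following property with probability tending to $1$ as $n\to\infty$: for any set $Z\subset\{1,\ldots,m\}$ of size $|Z|\leq n/k^2$ there is a $\lceil 0.9k\rceil$-fold matching from $\Phi_Z$ to $N(\Phi_Z)$ in the factor graph of $\Phi$.
   Context: Random formula model: variables $V=\{x_1,\ldots,x_n\}$; a $k$-CNF is an ordered $m$-tuple of clauses $\Phi_1,\ldots,\Phi_m$, each an ordered $k$-tuple of literals $\Phi_{i1},\ldots,\Phi_{ik}$ (repetitions allowed); $\Phi$ is uniform over all $(2n)^{km}$ such formulas. $|l|$ denotes the variable underlying literal $l$. The factor graph of $\Phi$ is the bipartite graph whose vertices are the variables and the clauses $\Phi_1,\ldots,\Phi_m$, where each clause is adjacent to all variables occurring in it. $N(\Phi_i)$ is the set of variables occurring in $\Phi_i$; for $Z\subset\{1,\ldots,m\}$, $\Phi_Z$ denotes the set of clauses $\{\Phi_i:i\in Z\}$ and $N(\Phi_Z)=\bigcup_{i\in Z}N(\Phi_i)$. For disjoint vertex sets $A,B$, an $l$-fold matching from $A$ to $B$ is a set $M$ of $A$-$B$ edges such that each $a\in A$ is incident with exactly $l$ edges of $M$ and each $b\in B$ is incident with at most one edge of $M$. -}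

module Defs where

open import Data.Nat using (ℕ; zero; suc; _+_; _*_; _∸_; _^_; _≤_)
open import Data.Nat.DivMod using (_/_)
open import Data.Integer using (+_)
open import Data.Rational.Unnormalised using (ℚᵘ; mkℚᵘ; 0ℚᵘ) renaming (_+_ to _+q_; _*_ to _*q_; _≤_ to _≤q_)
open import Data.Fin using (Fin)
open import Data.Fin.Subset using (Subset; _∈_; _∉_; ∣_∣; ⊥)
open import Data.Bool using (Bool)
open import Data.Product using (_×_; Σ; proj₁; ∃-syntax)
open import Data.Vec using (Vec; lookup)
open import Data.List using (List; length)
import Data.List.Membership.Propositional as LMem
open import Data.Sum using (_⊎_)
open import Relation.Binary.PropositionalEquality using (_≡_)

Literal : ℕ → Set
Literal n = Fin n × Bool

var : ∀ {n} → Literal n → Fin n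
var = proj₁

-- A k-CNF with m clauses over n variables: ordered m-tuple of ordered k-tuples of literals.
-- There are exactly (2n)^(k*m) of them.
Formula : (n k m : ℕ) → Set
Formula n k m = Vec (Vec (Literal n) k) m

-- variable x belongs to N(Φ_i), i.e. clause i is adjacent to x in the factor graph
Occurs : ∀ {n k m} → Formula n k m → Fin m → Fin n → Set
Occurs Φ i x = ∃[ j ] var (lookup (lookup Φ i) j) ≡ x

-- An l-fold matching from Φ_Z to N(Φ_Z) in the factor graph.
-- The edge set M is encoded as: M i = set of variables joined by an M-edge to clause i.
IsMatching : ∀ {n k m} → Formula n k m → Subset m → ℕ → (Fin m → Subset n) → Set
IsMatching {n} {k} {m} Φ Z l M =
    (∀ i x → x ∈ M i → Occurs Φ i x)
  × (∀ i → i ∉ Z → M i ≡ ⊥)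
  × (∀ i → i ∈ Z → ∣ M i ∣ ≡ l)
  × (∀ i j x → x ∈ M i → x ∈ M j → i ≡ j)
-- (edges from Φ_Z land in N(Φ_Z) automatically since they are factor-graph edges)

HasMatching : ∀ {n k m} → Formula n k m → Subset m → ℕ → Set
HasMatching {n} {k} {m} Φ Z l = Σ (Fin m → Subset n) (IsMatching Φ Z l)

-- ⌈0.9 k⌉ = ⌈9k/10⌉
ceil09 : ℕ → ℕ
ceil09 k = (9 * k + 9) / 10

Good : ∀ {n k m} → Formula n k m → Set
Good {n} {k} {m} Φ = (Z : Subset m) → ∣ Z ∣ * (k * k) ≤ n → HasMatching Φ Z (ceil09 k)

-- ln 2 = Σ_{j≥1} 1/(j 2^j).  lnPartial N = Σ_{j=1}^{N} 1/(j 2^j)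
lnPartial : ℕ → ℚᵘ
lnPartial zero = 0ℚᵘ
lnPartial (suc N) = lnPartial N +q mkℚᵘ (+ 1) ((suc N * 2 ^ suc N) ∸ 1)

-- upper bound for the tail Σ_{j>N} 1/(j 2^j) ≤ 1/((N+1) 2^N)
lnTail : ℕ → ℚᵘ
lnTail N = mkℚᵘ (+ 1) ((suc N * 2 ^ N) ∸ 1)

-- a ≤ b · ln 2 (exact real comparison, characterised via upper approximations of ln 2)
AtMostTimesLn2 : ℕ → ℕ → Set
AtMostTimesLn2 a b = ∀ N → mkℚᵘ (+ a) 0 ≤q (mkℚᵘ (+ b) 0 *q (lnPartial N +q lnTail N))

-- Pr[Φ not Good] ≤ 1/(suc j): there is a list of at most (2n)^(km)/(suc j) formulas
-- containing every formula which is not Good.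
BadProbAtMost : (n k m j : ℕ) → Set
BadProbAtMost n k m j =
  Σ (List (Formula n k m)) λ L →
      (length L * suc j ≤ (2 * n) ^ (k * m))
    × ((Φ : Formula n k m) → Good Φ ⊎ LMem._∈_ Φ L)

-- Greedy matching: if some clause c of Z has q = ⌈0.9k⌉ positions whose variables are lonely
-- in Φ_Z (occur exactly once there), match c to q of these variables, which lie in no other
-- clause of Z, and recurse on Z - c. The greedy procedure only gets stuck on a Z in which
-- every clause has more than k - q ≥ 2⌊k/20⌋ positions on shared variables, and then the
-- sequence of the |Z|k literals of Φ_Z has at least |Z|⌊k/20⌋ repeats (positions whose
-- variable reappears later). Such sequences are rare, since a repeat is a pointer to a later
-- position and a sign rather than one of 2n free literals. A union bound over |Z| = s and Z,
-- using C(m,s) ≤ (4m/s)^s and m ≤ 2^k n, leaves at most (2n)^(km)/n² formulas with a stuck Z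
-- of each size, hence a fraction at most (n+1)/n² of all formulas.
module Submission where

open import Defs
open import Data.Nat using (ℕ; _*_; _^_; _≤_; _<_)
open import Data.Product using (Σ; _×_)

open import Data.Nat hiding (_≟_; ∣_-_∣)
open import Data.Nat.Properties hiding (_≟_)
open import Data.Nat.Combinatorics using (_C_; k>n⇒nCk≡0; nCk+nC[k+1]≡[n+1]C[k+1])
open import Data.Nat.DivMod using (_/_; _%_; m/n*n≤m; m≡m%n+[m/n]*n; m%n<n; /-monoˡ-≤)
open import Data.Nat.Tactic.RingSolver using (solve-∀)
open import Data.Nat.ListAction using (sum)
open import Data.Nat.ListAction.Properties using (sum-++)
open import Data.Bool using (Bool; true; false; not; _∧_)
open import Data.Fin using (Fin; zero; suc) renaming (_≟_ to _≟ᶠ_)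
open import Data.Fin.Properties using (all?; ¬∀⟶∃¬)
open import Data.Fin.Subset using (Subset; _∈_; _∉_; _⊆_; ∣_∣; ⊥; ⁅_⁆; _-_; Nonempty; Empty)
open import Data.Fin.Subset.Properties
  using (∉⊥; _∈?_; anySubset?; nonempty?; ∣⊥∣≡0; x∈p∧x≢y⇒x∈p-y; p─q⊆p; x∈p⇒∣p-x∣<∣p∣)
open import Data.List
  using (List; []; _∷_; _++_; length; map; filter; upTo; allFin; concatMap; cartesianProductWith)
open import Data.List.Properties using (length-++; length-map; length-upTo; length-tabulate; length-filter; map-++)
open import Data.List.Relation.Unary.Any using (here; there)
import Data.List.Relation.Unary.Any.Properties as Any
open import Data.List.Membership.Propositional using () renaming (_∈_ to _∈ₗ_)
open import Data.List.Membership.Propositional.Properties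
  using (∈-map⁺; ∈-map⁻; ∈-++⁺ˡ; ∈-++⁺ʳ; ∈-++⁻; ∈-concat⁺′; ∈-concat⁻′; ∈-allFin; ∈-upTo⁺; ∈-filter⁺; ∈-filter⁻)
open import Data.Vec using (Vec; []; _∷_; lookup; toList; tabulate; replicate; here; there)
open import Data.Vec.Properties using (length-toList; lookup∘tabulate; []=⇒lookup)
open import Data.Product using (_,_; proj₁; proj₂; ∃-syntax)
open import Data.Sum using (_⊎_; inj₁; inj₂)
import Data.Integer as ℤ
import Data.Integer.Properties as ℤ
open import Data.Rational.Unnormalised using (*≤*)
open import Relation.Nullary using (Dec; yes; no; ¬_; contradiction)
open import Relation.Nullary.Decidable using (_×-dec_; _→-dec_)
open import Relation.Binary.PropositionalEquality
open import Function using (_∘′_)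
open import Algebra.Properties.CommutativeMonoid.Sum +-0-commutativeMonoid
  using (sum-syntax; sum-cong-≗; sum-replicate-zero; ∑-distrib-+) renaming (sum to ∑)

-- Elementary estimates

^-distrib-* : ∀ a b s → (a * b) ^ s ≡ a ^ s * b ^ s
^-distrib-* a b zero = refl
^-distrib-* a b (suc s) rewrite ^-distrib-* a b s = shuffle a b (a ^ s) (b ^ s)
  where
  shuffle : ∀ a b x y → a * b * (x * y) ≡ a * x * (b * y)
  shuffle = solve-∀

^-swap : ∀ x a s → x ^ (s * a) ≡ (x ^ a) ^ s
^-swap x a s = trans (cong (x ^_) (*-comm s a)) (sym (^-*-assoc x a s))

[x^3]^s≡x^s*[x^s*x^s] : ∀ x s → (x ^ 3) ^ s ≡ x ^ s * (x ^ s * x ^ s)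
[x^3]^s≡x^s*[x^s*x^s] x s = begin
    (x * (x * (x * 1))) ^ s       ≡⟨ ^-distrib-* x _ s ⟩
    x ^ s * (x * (x * 1)) ^ s     ≡⟨ cong (x ^ s *_) (^-distrib-* x _ s) ⟩
    x ^ s * (x ^ s * (x * 1) ^ s) ≡⟨ cong (λ z → x ^ s * (x ^ s * z ^ s)) (*-identityʳ x) ⟩
    x ^ s * (x ^ s * x ^ s)       ∎
  where open ≡-Reasoning

m^[1+s]+[1+s]m^s≤[1+m]^[1+s] : ∀ m s → m ^ suc s + suc s * m ^ s ≤ suc m ^ suc s
m^[1+s]+[1+s]m^s≤[1+m]^[1+s] m zero = ≤-reflexive (base m)
  where
  base : ∀ m → m * 1 + 1 * 1 ≡ suc m * 1
  base = solve-∀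
m^[1+s]+[1+s]m^s≤[1+m]^[1+s] m (suc s) = begin
    m ^ suc (suc s) + suc (suc s) * m ^ suc s
  ≤⟨ m≤m+n _ (suc s * m ^ s) ⟩
    m ^ suc (suc s) + suc (suc s) * m ^ suc s + suc s * m ^ s
  ≡⟨ factor m (suc s) (m ^ s) ⟩
    suc m * (m ^ suc s + suc s * m ^ s)
  ≤⟨ *-monoʳ-≤ (suc m) (m^[1+s]+[1+s]m^s≤[1+m]^[1+s] m s) ⟩
    suc m ^ suc (suc s)
  ∎
  where
  open ≤-Reasoning
  factor : ∀ m t p → m * (m * p) + (1 + t) * (m * p) + t * p ≡ (1 + m) * (m * p + t * p)
  factor = solve-∀

mCs*s!≤m^s : ∀ m s → (m C s) * s ! ≤ m ^ s
mCs*s!≤m^s m zero = ≤-refl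
mCs*s!≤m^s zero (suc s) = z≤n
mCs*s!≤m^s (suc m) (suc s) = begin
    (suc m C suc s) * (suc s * s !)
  ≡⟨ cong (_* (suc s * s !)) (sym (nCk+nC[k+1]≡[n+1]C[k+1] m s)) ⟩
    (m C s + m C suc s) * (suc s * s !)
  ≡⟨ distribute (m C s) (m C suc s) (suc s) (s !) ⟩
    (m C suc s) * (suc s * s !) + suc s * ((m C s) * s !)
  ≤⟨ +-mono-≤ (mCs*s!≤m^s m (suc s)) (*-monoʳ-≤ (suc s) (mCs*s!≤m^s m s)) ⟩
    m ^ suc s + suc s * m ^ s
  ≤⟨ m^[1+s]+[1+s]m^s≤[1+m]^[1+s] m s ⟩
    suc m ^ suc s
  ∎
  where
  open ≤-Reasoning
  distribute : ∀ a b t f → (a + b) * (t * f) ≡ b * (t * f) + t * (a * f)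
  distribute = solve-∀

[1+s+r]^s*r≤[s+r]^[1+s] : ∀ s r → suc (s + r) ^ s * r ≤ (s + r) ^ suc s
[1+s+r]^s*r≤[s+r]^[1+s] zero r = ≤-reflexive (trans (+-identityʳ r) (sym (*-identityʳ r)))
[1+s+r]^s*r≤[s+r]^[1+s] (suc s) r = *-cancelʳ-≤ _ _ (suc r) scaled
  where
  open ≤-Reasoning
  X = suc (suc s + r)
  Y = suc s + r
  ih : X ^ s * suc r ≤ Y ^ suc s
  ih = subst₂ (λ a b → suc a ^ s * suc r ≤ b ^ suc s) (+-suc s r) (+-suc s r)
              ([1+s+r]^s*r≤[s+r]^[1+s] s (suc r))
  Xr≤Y[1+r] : X * r ≤ Y * suc r
  Xr≤Y[1+r] = ≤-trans (≤-reflexive (split s r))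
                (≤-trans (+-monoʳ-≤ (Y * r) (m≤n+m r (suc s))) (≤-reflexive (merge s r)))
    where
    split : ∀ s r → (2 + s + r) * r ≡ (1 + s + r) * r + r
    split = solve-∀
    merge : ∀ s r → (1 + s + r) * r + (1 + s + r) ≡ (1 + s + r) * (1 + r)
    merge = solve-∀
  scaled : X ^ suc s * r * suc r ≤ Y ^ suc (suc s) * suc r
  scaled = begin
      X ^ suc s * r * suc r            ≡⟨ regroup X (X ^ s) r (suc r) ⟩
      X * r * (X ^ s * suc r)          ≤⟨ *-mono-≤ (≤-trans Xr≤Y[1+r] (≤-reflexive (*-comm Y (suc r)))) ih ⟩
      suc r * Y * Y ^ suc s            ≡⟨ rotate (suc r) Y (Y ^ suc s) ⟩
      Y ^ suc (suc s) * suc r          ∎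
    where
    regroup : ∀ x p r t → x * p * r * t ≡ x * r * (p * t)
    regroup = solve-∀
    rotate : ∀ t y q → t * y * q ≡ y * q * t
    rotate = solve-∀

-- (1 + 1/s)^s ≤ 4, derived from (1 + 1/2s)^s ≤ 2 by squaring.
[1+s]^s≤4*s^s : ∀ s → suc s ^ s ≤ 4 * s ^ s
[1+s]^s≤4*s^s zero = s≤s z≤n
[1+s]^s≤4*s^s s@(suc _) =
  *-cancelʳ-≤ _ _ (D ^ s * D ^ s) {{m*n≢0 (D ^ s) (D ^ s) {{m^n≢0 D s}} {{m^n≢0 D s}}}} squared
  where
  open ≤-Reasoning
  D = s + s
  E = suc D
  E^s≤2D^s : E ^ s ≤ 2 * D ^ s
  E^s≤2D^s = *-cancelʳ-≤ _ _ s (≤-trans ([1+s+r]^s*r≤[s+r]^[1+s] s s) (≤-reflexive (double s (D ^ s))))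
    where
    double : ∀ s p → (s + s) * p ≡ (2 * p) * s
    double = solve-∀
  base : suc s * (D * D) ≤ s * (E * E)
  base = ≤-trans (m≤m+n _ s) (≤-reflexive (expand s))
    where
    expand : ∀ s → (1 + s) * ((s + s) * (s + s)) + s ≡ s * ((1 + (s + s)) * (1 + (s + s)))
    expand = solve-∀
  squared : suc s ^ s * (D ^ s * D ^ s) ≤ 4 * s ^ s * (D ^ s * D ^ s)
  squared = begin
      suc s ^ s * (D ^ s * D ^ s)    ≡⟨ cong (suc s ^ s *_) (sym (^-distrib-* D D s)) ⟩
      suc s ^ s * (D * D) ^ s        ≡⟨ sym (^-distrib-* (suc s) (D * D) s) ⟩
      (suc s * (D * D)) ^ s          ≤⟨ ^-monoˡ-≤ s base ⟩
      (s * (E * E)) ^ s              ≡⟨ trans (^-distrib-* s (E * E) s) (cong (s ^ s *_) (^-distrib-* E E s)) ⟩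
      s ^ s * (E ^ s * E ^ s)        ≤⟨ *-monoʳ-≤ (s ^ s) (*-mono-≤ E^s≤2D^s E^s≤2D^s) ⟩
      s ^ s * ((2 * D ^ s) * (2 * D ^ s)) ≡⟨ collect (s ^ s) (D ^ s) ⟩
      4 * s ^ s * (D ^ s * D ^ s)    ∎
    where
    collect : ∀ a p → a * ((2 * p) * (2 * p)) ≡ 4 * a * (p * p)
    collect = solve-∀

s^s≤4^s*s! : ∀ s → s ^ s ≤ 4 ^ s * s !
s^s≤4^s*s! zero = ≤-refl
s^s≤4^s*s! (suc s) = begin
    suc s * suc s ^ s               ≤⟨ *-monoʳ-≤ (suc s) ([1+s]^s≤4*s^s s) ⟩
    suc s * (4 * s ^ s)             ≤⟨ *-monoʳ-≤ (suc s) (*-monoʳ-≤ 4 (s^s≤4^s*s! s)) ⟩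
    suc s * (4 * (4 ^ s * s !))     ≡⟨ regroup (suc s) (4 ^ s) (s !) ⟩
    4 * 4 ^ s * (suc s * s !)       ∎
  where
  open ≤-Reasoning
  regroup : ∀ a b c → a * (4 * (b * c)) ≡ 4 * b * (a * c)
  regroup = solve-∀

mCs*s^s≤4^s*m^s : ∀ m s → (m C s) * s ^ s ≤ 4 ^ s * m ^ s
mCs*s^s≤4^s*m^s m s = begin
    (m C s) * s ^ s              ≤⟨ *-monoʳ-≤ (m C s) (s^s≤4^s*s! s) ⟩
    (m C s) * (4 ^ s * s !)      ≡⟨ x∙yz≈y∙xz (m C s) (4 ^ s) (s !) ⟩
    4 ^ s * ((m C s) * s !)      ≤⟨ *-monoʳ-≤ (4 ^ s) (mCs*s!≤m^s m s) ⟩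
    4 ^ s * m ^ s              ∎
  where
  open ≤-Reasoning
  x∙yz≈y∙xz : ∀ a b c → a * (b * c) ≡ b * (a * c)
  x∙yz≈y∙xz = solve-∀

1+t≤4^t : ∀ t → suc t ≤ 4 ^ t
1+t≤4^t zero = ≤-refl
1+t≤4^t (suc t) = ≤-trans (+-mono-≤ (m^n>0 4 t) (1+t≤4^t t))
                          (≤-trans (m≤m+n (4 ^ t + 4 ^ t) (4 ^ t + 4 ^ t)) (≤-reflexive (four (4 ^ t))))
  where
  four : ∀ p → p + p + (p + p) ≡ 4 * p
  four = solve-∀

s^s*n≤n^s : ∀ t n → 4 * suc t ≤ n → suc t ^ suc t * n ≤ n ^ suc t
s^s*n≤n^s t n 4s≤n = begin
    suc t * suc t ^ t * n      ≤⟨ *-monoˡ-≤ n (*-monoˡ-≤ (suc t ^ t) (1+t≤4^t t)) ⟩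
    4 ^ t * suc t ^ t * n      ≡⟨ cong (_* n) (sym (^-distrib-* 4 (suc t) t)) ⟩
    (4 * suc t) ^ t * n        ≤⟨ *-monoˡ-≤ n (^-monoˡ-≤ t 4s≤n) ⟩
    n ^ t * n                  ≡⟨ *-comm (n ^ t) n ⟩
    n ^ suc t                  ∎
  where open ≤-Reasoning

[1+j]*[1+n]≤n*n : ∀ j n → j + 2 ≤ n → suc j * suc n ≤ n * n
[1+j]*[1+n]≤n*n j n j+2≤n = begin
    suc j * suc n        ≡⟨ *-suc (suc j) n ⟩
    suc j + suc j * n    ≤⟨ +-monoˡ-≤ (suc j * n) (≤-trans (n≤1+n (suc j)) 2+j≤n) ⟩
    n + suc j * n        ≡⟨ *-comm (suc (suc j)) n ⟩
    n * suc (suc j)      ≤⟨ *-monoʳ-≤ n 2+j≤n ⟩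
    n * n                ∎
  where
  open ≤-Reasoning
  2+j≤n : suc (suc j) ≤ n
  2+j≤n = ≤-trans (≤-reflexive (+-comm 2 j)) j+2≤n

n²*[4^[1+k]*n*[sk]^w]^s≤[s*n^w]^s : ∀ n k v t → let s = suc t in
  s * (k * k) ≤ n → 4 * s ≤ n → 1 ≤ k →
  4 ^ suc k * k ^ (v + 3) ≤ k ^ v * k ^ v →
  n * n * (4 ^ suc k * n * (s * k) ^ (v + 3)) ^ s ≤ (s * n ^ (v + 3)) ^ s
n²*[4^[1+k]*n*[sk]^w]^s≤[s*n^w]^s n k@(suc _) v t sk²≤n 4s≤n _ 4^[1+k]k^w≤k^2v =
  *-cancelʳ-≤ _ _ (KK ^ s) {{m^n≢0 KK s {{m*n≢0 (k ^ v) (k ^ v) {{m^n≢0 k v}} {{m^n≢0 k v}}}}}} scaled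
  where
  open ≤-Reasoning
  s = suc t
  A = 4 ^ suc k
  K3 = k ^ (v + 3)
  KK = k ^ v * k ^ v
  a = (A * K3) ^ s
  b = n ^ s
  c = s ^ s
  d = (s ^ v * KK) ^ s
  e = KK ^ s
  f = (n ^ v) ^ s
  s^vk^2v≤n^v : s ^ v * KK ≤ n ^ v
  s^vk^2v≤n^v = ≤-trans (≤-reflexive (sym (trans (^-distrib-* s (k * k) v) (cong (s ^ v *_) (^-distrib-* k k v)))))
                        (^-monoˡ-≤ v sk²≤n)
  lhs : n * n * (A * n * (s * k) ^ (v + 3)) ^ s * KK ^ s ≡ n * n * (a * (b * ((c * (c * c)) * d)))
  lhs = begin-equality
      n * n * (A * n * (s * k) ^ (v + 3)) ^ s * KK ^ s
    ≡⟨ cong (λ z → n * n * (A * n * z) ^ s * KK ^ s) (trans (^-distrib-* s k (v + 3)) (cong (_* K3) (^-distribˡ-+-* s v 3))) ⟩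
      n * n * (A * n * (s ^ v * s ^ 3 * K3)) ^ s * KK ^ s
    ≡⟨ *-assoc (n * n) ((A * n * (s ^ v * s ^ 3 * K3)) ^ s) (KK ^ s) ⟩
      n * n * ((A * n * (s ^ v * s ^ 3 * K3)) ^ s * KK ^ s)
    ≡⟨ cong (n * n *_) (sym (^-distrib-* (A * n * (s ^ v * s ^ 3 * K3)) KK s)) ⟩
      n * n * (A * n * (s ^ v * s ^ 3 * K3) * KK) ^ s
    ≡⟨ cong (λ z → n * n * z ^ s) (regroup A n (s ^ v) (s ^ 3) K3 KK) ⟩
      n * n * ((A * K3) * (n * (s ^ 3 * (s ^ v * KK)))) ^ s
    ≡⟨ cong (n * n *_) distribute ⟩
      n * n * (a * (b * ((c * (c * c)) * d)))
    ∎
    where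
    regroup : ∀ A n p q K KK → A * n * (p * q * K) * KK ≡ (A * K) * (n * (q * (p * KK)))
    regroup = solve-∀
    distribute : (A * K3 * (n * (s ^ 3 * (s ^ v * KK)))) ^ s ≡ a * (b * ((c * (c * c)) * d))
    distribute = trans (^-distrib-* (A * K3) _ s) (cong (a *_)
                 (trans (^-distrib-* n _ s) (cong (b *_)
                 (trans (^-distrib-* (s ^ 3) (s ^ v * KK) s) (cong (_* d) ([x^3]^s≡x^s*[x^s*x^s] s s))))))
  rhs : (s * n ^ (v + 3)) ^ s * KK ^ s ≡ c * (f * (b * (b * b))) * e
  rhs = cong (_* e) (trans (^-distrib-* s (n ^ (v + 3)) s) (cong (c *_)
          (trans (cong (_^ s) (^-distribˡ-+-* n v 3)) (trans (^-distrib-* (n ^ v) (n ^ 3) s)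
          (cong (f *_) ([x^3]^s≡x^s*[x^s*x^s] n s))))))
  scaled : n * n * (A * n * (s * k) ^ (v + 3)) ^ s * KK ^ s ≤ (s * n ^ (v + 3)) ^ s * KK ^ s
  scaled = begin
      n * n * (A * n * (s * k) ^ (v + 3)) ^ s * KK ^ s
    ≡⟨ lhs ⟩
      n * n * (a * (b * ((c * (c * c)) * d)))
    ≤⟨ *-monoʳ-≤ (n * n) (*-mono-≤ (^-monoˡ-≤ s 4^[1+k]k^w≤k^2v)
                           (*-monoʳ-≤ b (*-monoʳ-≤ (c * (c * c)) (^-monoˡ-≤ s s^vk^2v≤n^v)))) ⟩
      n * n * (e * (b * ((c * (c * c)) * f)))
    ≡⟨ pair-up n e b c f ⟩
      (c * n) * (c * n) * (c * b * e * f)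
    ≤⟨ *-monoˡ-≤ (c * b * e * f) (*-mono-≤ (s^s*n≤n^s t n 4s≤n) (s^s*n≤n^s t n 4s≤n)) ⟩
      b * b * (c * b * e * f)
    ≡⟨ reorder b c e f ⟩
      c * (f * (b * (b * b))) * e
    ≡⟨ sym rhs ⟩
      (s * n ^ (v + 3)) ^ s * KK ^ s
    ∎
    where
    pair-up : ∀ n e b c f → n * n * (e * (b * ((c * (c * c)) * f))) ≡ (c * n) * (c * n) * (c * b * e * f)
    pair-up = solve-∀
    reorder : ∀ b c e f → b * b * (c * b * e * f) ≡ c * (f * (b * (b * b))) * e
    reorder = solve-∀

-- Counting the formulas with a stuck Z of size s, where G bounds the sequences of sk literals
-- with sw repeats, leaves a factor n² to spare.
[mCs]*G*n²≤[2n]^[sk] : ∀ m n k v t G → let s = suc t ; w = v + 3 in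
  m ≤ n * 2 ^ k → s * (k * k) ≤ n → 4 * s ≤ n → 1 ≤ k →
  4 ^ suc k * k ^ (v + 3) ≤ k ^ v * k ^ v →
  G * (2 * n) ^ (s * w) ≤ 2 ^ (s * k) * (2 * (s * k)) ^ (s * w) * (2 * n) ^ (s * k) →
  (m C s) * G * (n * n) ≤ (2 * n) ^ (s * k)
[mCs]*G*n²≤[2n]^[sk] m n k v t G m≤n2^k sk²≤n 4s≤n 1≤k 4^[1+k]k^w≤k^2v G-bound =
  *-cancelʳ-≤ _ _ (c * Q) {{cQ≢0}} scaled
  where
  open ≤-Reasoning
  s = suc t
  w = v + 3
  c = s ^ s
  Q = (2 * n) ^ (s * w)
  cQ≢0 : NonZero (c * Q)
  cQ≢0 = m*n≢0 c Q {{m^n≢0 s s}} {{m^n≢0 (2 * n) (s * w) {{m*n≢0 2 n {{_}} {{>-nonZero (≤-trans (s≤s z≤n) 4s≤n)}}}}}}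
  P2 = 2 ^ (s * k)
  R = (2 * (s * k)) ^ (s * w)
  T = (2 * n) ^ (s * k)
  X = 4 ^ suc k * n * (s * k) ^ w
  expand-base : 4 * (n * 2 ^ k) * 2 ^ k * (2 * (s * k)) ^ w ≡ X * 2 ^ w
  expand-base = begin-equality
      4 * (n * 2 ^ k) * 2 ^ k * (2 * (s * k)) ^ w
    ≡⟨ cong (4 * (n * 2 ^ k) * 2 ^ k *_) (^-distrib-* 2 (s * k) w) ⟩
      4 * (n * 2 ^ k) * 2 ^ k * (2 ^ w * (s * k) ^ w)
    ≡⟨ regroup 4 n (2 ^ k) (2 ^ w) ((s * k) ^ w) ⟩
      4 * (2 ^ k * 2 ^ k) * n * (s * k) ^ w * 2 ^ w
    ≡⟨ cong (λ z → 4 * z * n * (s * k) ^ w * 2 ^ w) (sym (^-distrib-* 2 2 k)) ⟩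
      X * 2 ^ w
    ∎
    where
    regroup : ∀ f n p q r → f * (n * p) * p * (q * r) ≡ f * (p * p) * n * r * q
    regroup = solve-∀
  expand-cost : 4 ^ s * (n * 2 ^ k) ^ s * P2 * R ≡ X ^ s * (2 ^ w) ^ s
  expand-cost = begin-equality
      4 ^ s * (n * 2 ^ k) ^ s * P2 * R
    ≡⟨ cong₂ (λ a b → 4 ^ s * (n * 2 ^ k) ^ s * a * b) (^-swap 2 k s) (^-swap (2 * (s * k)) w s) ⟩
      4 ^ s * (n * 2 ^ k) ^ s * (2 ^ k) ^ s * ((2 * (s * k)) ^ w) ^ s
    ≡⟨ sym (trans (^-distrib-* (4 * (n * 2 ^ k) * 2 ^ k) ((2 * (s * k)) ^ w) s)
             (cong (_* ((2 * (s * k)) ^ w) ^ s) (trans (^-distrib-* (4 * (n * 2 ^ k)) (2 ^ k) s)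
             (cong (_* (2 ^ k) ^ s) (^-distrib-* 4 (n * 2 ^ k) s))))) ⟩
      (4 * (n * 2 ^ k) * 2 ^ k * (2 * (s * k)) ^ w) ^ s
    ≡⟨ cong (_^ s) expand-base ⟩
      (X * 2 ^ w) ^ s
    ≡⟨ ^-distrib-* X (2 ^ w) s ⟩
      X ^ s * (2 ^ w) ^ s
    ∎
  expand-savings : (s * n ^ w) ^ s * (2 ^ w) ^ s ≡ c * Q
  expand-savings = begin-equality
      (s * n ^ w) ^ s * (2 ^ w) ^ s    ≡⟨ sym (^-distrib-* (s * n ^ w) (2 ^ w) s) ⟩
      (s * n ^ w * 2 ^ w) ^ s          ≡⟨ cong (_^ s) (swap s (n ^ w) (2 ^ w)) ⟩
      (s * (2 ^ w * n ^ w)) ^ s        ≡⟨ ^-distrib-* s (2 ^ w * n ^ w) s ⟩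
      c * (2 ^ w * n ^ w) ^ s          ≡⟨ cong (λ z → c * z ^ s) (sym (^-distrib-* 2 n w)) ⟩
      c * ((2 * n) ^ w) ^ s            ≡⟨ cong (c *_) (sym (^-swap (2 * n) w s)) ⟩
      c * Q                            ∎
    where
    swap : ∀ s a b → s * a * b ≡ s * (b * a)
    swap = solve-∀
  scaled : (m C s) * G * (n * n) * (c * Q) ≤ T * (c * Q)
  scaled = begin
      (m C s) * G * (n * n) * (c * Q)
    ≡⟨ regroup (m C s) G (n * n) c Q ⟩
      ((m C s) * c) * (G * Q) * (n * n)
    ≤⟨ *-monoˡ-≤ (n * n) (*-mono-≤ (mCs*s^s≤4^s*m^s m s) G-bound) ⟩
      (4 ^ s * m ^ s) * (P2 * R * T) * (n * n)
    ≤⟨ *-monoˡ-≤ (n * n) (*-monoˡ-≤ (P2 * R * T) (*-monoʳ-≤ (4 ^ s) (^-monoˡ-≤ s m≤n2^k))) ⟩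
      (4 ^ s * (n * 2 ^ k) ^ s) * (P2 * R * T) * (n * n)
    ≡⟨ factor-T (4 ^ s) ((n * 2 ^ k) ^ s) P2 R T (n * n) ⟩
      T * (n * n * (4 ^ s * (n * 2 ^ k) ^ s * P2 * R))
    ≡⟨ cong (λ z → T * (n * n * z)) expand-cost ⟩
      T * (n * n * (X ^ s * (2 ^ w) ^ s))
    ≡⟨ cong (T *_) (sym (*-assoc (n * n) (X ^ s) ((2 ^ w) ^ s))) ⟩
      T * (n * n * X ^ s * (2 ^ w) ^ s)
    ≤⟨ *-monoʳ-≤ T (*-monoˡ-≤ ((2 ^ w) ^ s) (n²*[4^[1+k]*n*[sk]^w]^s≤[s*n^w]^s n k v t sk²≤n 4s≤n 1≤k 4^[1+k]k^w≤k^2v)) ⟩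
      T * ((s * n ^ w) ^ s * (2 ^ w) ^ s)
    ≡⟨ cong (T *_) expand-savings ⟩
      T * (c * Q)
    ∎
    where
    regroup : ∀ b g nn c q → b * g * nn * (c * q) ≡ (b * c) * (g * q) * nn
    regroup = solve-∀
    factor-T : ∀ f x p r t nn → (f * x) * (p * r * t) * nn ≡ t * (nn * (f * x * p * r))
    factor-T = solve-∀

2*[k/20]+⌈0∙9k⌉≤k : ∀ k → 2 * (k / 20) + ceil09 k ≤ k
2*[k/20]+⌈0∙9k⌉≤k k = ≤-pred (*-cancelʳ-< 10 (2 * w + q) (suc k) lt)
  where
  open ≤-Reasoning
  w = k / 20
  q = ceil09 k
  lt : (2 * w + q) * 10 < suc k * 10
  lt = begin-strict
      (2 * w + q) * 10   ≡⟨ expand w q ⟩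
      w * 20 + q * 10    ≤⟨ +-mono-≤ (m/n*n≤m k 20) (m/n*n≤m (9 * k + 9) 10) ⟩
      k + (9 * k + 9)    <⟨ ≤-reflexive (collect k) ⟩
      suc k * 10         ∎
    where
    expand : ∀ w q → (2 * w + q) * 10 ≡ w * 20 + q * 10
    expand = solve-∀
    collect : ∀ k → suc (k + (9 * k + 9)) ≡ suc k * 10
    collect = solve-∀

K₀ : ℕ
K₀ = 2 ^ 60

20≤k/20 : ∀ {k} → K₀ ≤ k → 20 ≤ k / 20
20≤k/20 K₀≤k = ≤-trans (≤ᵇ⇒≤ 20 (K₀ / 20) _) (/-monoˡ-≤ 20 K₀≤k)

-- Writing k/20 = b + 20, one has 4^(k+1) ≤ 2^(40b + 840) ≤ K₀^(b + 14) ≤ k^(b + 14).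
4^[1+k]*k^[v+3]≤k^v*k^v : ∀ {k} → K₀ ≤ k → let v = k / 20 ∸ 3 in 4 ^ suc k * k ^ (v + 3) ≤ k ^ v * k ^ v
4^[1+k]*k^[v+3]≤k^v*k^v {k} K₀≤k = begin
    4 ^ suc k * k ^ (v + 3)        ≡⟨ cong (λ z → 4 ^ suc k * k ^ z) v+3≡b+20 ⟩
    4 ^ suc k * k ^ (b + 20)       ≤⟨ *-monoˡ-≤ (k ^ (b + 20)) 4^[1+k]≤k^[b+14] ⟩
    k ^ (b + 14) * k ^ (b + 20)    ≡⟨ sym (^-distribˡ-+-* k (b + 14) (b + 20)) ⟩
    k ^ ((b + 14) + (b + 20))      ≡⟨ cong (k ^_) (rebalance b) ⟩
    k ^ ((b + 17) + (b + 17))      ≡⟨ ^-distribˡ-+-* k (b + 17) (b + 17) ⟩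
    k ^ (b + 17) * k ^ (b + 17)    ≡⟨ cong (λ z → k ^ z * k ^ z) (sym v≡b+17) ⟩
    k ^ v * k ^ v                  ∎
  where
  open ≤-Reasoning
  w = k / 20
  v = w ∸ 3
  b = w ∸ 20
  w≡b+20 : w ≡ b + 20
  w≡b+20 = sym (m∸n+n≡m (20≤k/20 K₀≤k))
  v+3≡b+20 : v + 3 ≡ b + 20
  v+3≡b+20 = trans (m∸n+n≡m (≤-trans (≤ᵇ⇒≤ 3 20 _) (20≤k/20 K₀≤k))) w≡b+20
  v≡b+17 : v ≡ b + 17
  v≡b+17 = trans (cong (_∸ 3) w≡b+20) (trans (cong (_∸ 3) (+-comm b 20)) (+-comm 17 b))
  rebalance : ∀ b → (b + 14) + (b + 20) ≡ (b + 17) + (b + 17)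
  rebalance = solve-∀
  1+k≤20b+420 : suc k ≤ 20 * b + 420
  1+k≤20b+420 = begin
      suc k                    ≡⟨ cong suc (m≡m%n+[m/n]*n k 20) ⟩
      suc (k % 20 + w * 20)    ≤⟨ +-monoˡ-≤ (w * 20) (m%n<n k 20) ⟩
      20 + w * 20              ≡⟨ cong (λ z → 20 + z * 20) w≡b+20 ⟩
      20 + (b + 20) * 20       ≡⟨ expand b ⟩
      20 * b + 420             ∎
    where
    expand : ∀ b → 20 + (b + 20) * 20 ≡ 20 * b + 420
    expand = solve-∀
  4^[1+k]≤k^[b+14] : 4 ^ suc k ≤ k ^ (b + 14)
  4^[1+k]≤k^[b+14] = begin
      4 ^ suc k                ≤⟨ ^-monoʳ-≤ 4 1+k≤20b+420 ⟩
      4 ^ (20 * b + 420)       ≡⟨ ^-*-assoc 2 2 (20 * b + 420) ⟩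
      2 ^ (2 * (20 * b + 420)) ≤⟨ ^-monoʳ-≤ 2 (≤-trans (≤-reflexive (double b)) (+-monoˡ-≤ 840 (*-monoˡ-≤ b (≤ᵇ⇒≤ 40 60 _)))) ⟩
      2 ^ (60 * b + 840)       ≡⟨ cong (2 ^_) (factor b) ⟩
      2 ^ (60 * (b + 14))      ≡⟨ ^-*-assoc 2 60 (b + 14) ⟨
      K₀ ^ (b + 14)            ≤⟨ ^-monoˡ-≤ (b + 14) K₀≤k ⟩
      k ^ (b + 14)             ∎
    where
    double : ∀ b → 2 * (20 * b + 420) ≡ 40 * b + 840
    double = solve-∀
    factor : ∀ b → 60 * b + 840 ≡ 60 * (b + 14)
    factor = solve-∀

-- Enumerations of lists

*-length≤sum-map : ∀ {A : Set} (f : A → ℕ) a xs → (∀ x → x ∈ₗ xs → a ≤ f x) → length xs * a ≤ sum (map f xs)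
*-length≤sum-map f a [] bound = z≤n
*-length≤sum-map f a (x ∷ xs) bound = +-mono-≤ (bound x (here refl)) (*-length≤sum-map f a xs (λ y y∈ → bound y (there y∈)))

module _ {A B : Set} where

  ∈-concatMap⁺ : ∀ {f : A → List B} {x xs y} → x ∈ₗ xs → y ∈ₗ f x → y ∈ₗ concatMap f xs
  ∈-concatMap⁺ {f} x∈xs y∈fx = ∈-concat⁺′ y∈fx (∈-map⁺ f x∈xs)

  ∈-concatMap⁻ : ∀ (f : A → List B) xs {y} → y ∈ₗ concatMap f xs → ∃[ x ] (x ∈ₗ xs × y ∈ₗ f x)
  ∈-concatMap⁻ f xs y∈ with ∈-concat⁻′ (map f xs) y∈
  ... | ys , y∈ys , ys∈ with ∈-map⁻ f ys∈
  ... | x , x∈xs , refl = x , x∈xs , y∈ys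

  length-concatMap≤ : ∀ (f : A → List B) xs c → (∀ x → x ∈ₗ xs → length (f x) ≤ c) →
                      length (concatMap f xs) ≤ length xs * c
  length-concatMap≤ f [] c bound = z≤n
  length-concatMap≤ f (x ∷ xs) c bound = begin
      length (f x ++ concatMap f xs)            ≡⟨ length-++ (f x) ⟩
      length (f x) + length (concatMap f xs)    ≤⟨ +-mono-≤ (bound x (here refl))
                                                     (length-concatMap≤ f xs c (λ y y∈ → bound y (there y∈))) ⟩
      c + length xs * c                         ∎
    where open ≤-Reasoning

  *-length-concatMap≤ : ∀ (f : A → List B) xs d c → (∀ x → x ∈ₗ xs → length (f x) * d ≤ c) →
                        length (concatMap f xs) * d ≤ length xs * c
  *-length-concatMap≤ f [] d c bound = z≤n
  *-length-concatMap≤ f (x ∷ xs) d c bound = begin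
      length (f x ++ concatMap f xs) * d              ≡⟨ cong (_* d) (length-++ (f x)) ⟩
      (length (f x) + length (concatMap f xs)) * d    ≡⟨ *-distribʳ-+ d (length (f x)) _ ⟩
      length (f x) * d + length (concatMap f xs) * d  ≤⟨ +-mono-≤ (bound x (here refl))
                                                           (*-length-concatMap≤ f xs d c (λ y y∈ → bound y (there y∈))) ⟩
      c + length xs * c                               ∎
    where open ≤-Reasoning

  sum-map-concatMap : ∀ (f : B → ℕ) (g : A → List B) xs →
                      sum (map f (concatMap g xs)) ≡ sum (map (λ x → sum (map f (g x))) xs)
  sum-map-concatMap f g [] = refl
  sum-map-concatMap f g (x ∷ xs) =
    trans (cong sum (map-++ f (g x) (concatMap g xs)))
          (trans (sum-++ (map f (g x)) _) (cong (sum (map f (g x)) +_) (sum-map-concatMap f g xs)))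

module _ {A B C : Set} (f : A → B → C) where

  length-cartesianProductWith : ∀ xs ys → length (cartesianProductWith f xs ys) ≡ length xs * length ys
  length-cartesianProductWith [] ys = refl
  length-cartesianProductWith (x ∷ xs) ys =
    trans (length-++ (map (f x) ys)) (cong₂ _+_ (length-map (f x) ys) (length-cartesianProductWith xs ys))

  ∈-cartesianProductWith⁺ : ∀ {x y xs ys} → x ∈ₗ xs → y ∈ₗ ys → f x y ∈ₗ cartesianProductWith f xs ys
  ∈-cartesianProductWith⁺ = Any.cartesianProductWith⁺ f (cong₂ f)

  ∈-cartesianProductWith⁻ : ∀ xs ys {z} → z ∈ₗ cartesianProductWith f xs ys →
                            ∃[ x ] ∃[ y ] (x ∈ₗ xs × y ∈ₗ ys × z ≡ f x y)
  ∈-cartesianProductWith⁻ (x ∷ xs) ys z∈ with ∈-++⁻ (map (f x) ys) z∈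
  ... | inj₁ z∈map with ∈-map⁻ (f x) z∈map
  ...   | y , y∈ys , refl = x , y , here refl , y∈ys , refl
  ∈-cartesianProductWith⁻ (x ∷ xs) ys z∈ | inj₂ z∈rest with ∈-cartesianProductWith⁻ xs ys z∈rest
  ... | x′ , y , x′∈xs , y∈ys , refl = x′ , y , there x′∈xs , y∈ys , refl

module _ {A : Set} where

  listsOfLength : ℕ → List A → List (List A)
  listsOfLength zero xs = [] ∷ []
  listsOfLength (suc r) xs = cartesianProductWith _∷_ xs (listsOfLength r xs)

  length-listsOfLength : ∀ r xs → length (listsOfLength r xs) ≡ length xs ^ r
  length-listsOfLength zero xs = refl
  length-listsOfLength (suc r) xs =
    trans (length-cartesianProductWith _∷_ xs (listsOfLength r xs)) (cong (length xs *_) (length-listsOfLength r xs))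

  ∈-listsOfLength⁺ : ∀ {xs} → (∀ a → a ∈ₗ xs) → ∀ l → l ∈ₗ listsOfLength (length l) xs
  ∈-listsOfLength⁺ all∈ [] = here refl
  ∈-listsOfLength⁺ all∈ (a ∷ l) = ∈-cartesianProductWith⁺ _∷_ (all∈ a) (∈-listsOfLength⁺ all∈ l)

  ∈-listsOfLength⁻ : ∀ r xs {l} → l ∈ₗ listsOfLength r xs → length l ≡ r
  ∈-listsOfLength⁻ zero xs (here refl) = refl
  ∈-listsOfLength⁻ (suc r) xs l∈ with ∈-cartesianProductWith⁻ _∷_ xs (listsOfLength r xs) l∈
  ... | _ , l′ , _ , l′∈ , refl = cong suc (∈-listsOfLength⁻ r xs l′∈)

  vectorsOfLength : ∀ k → List A → List (Vec A k)
  vectorsOfLength zero xs = [] ∷ []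
  vectorsOfLength (suc k) xs = cartesianProductWith _∷_ xs (vectorsOfLength k xs)

  length-vectorsOfLength : ∀ k xs → length (vectorsOfLength k xs) ≡ length xs ^ k
  length-vectorsOfLength zero xs = refl
  length-vectorsOfLength (suc k) xs =
    trans (length-cartesianProductWith _∷_ xs (vectorsOfLength k xs)) (cong (length xs *_) (length-vectorsOfLength k xs))

  ∈-vectorsOfLength : ∀ {xs k} → (∀ a → a ∈ₗ xs) → (v : Vec A k) → v ∈ₗ vectorsOfLength k xs
  ∈-vectorsOfLength all∈ [] = here refl
  ∈-vectorsOfLength all∈ (a ∷ v) = ∈-cartesianProductWith⁺ _∷_ (all∈ a) (∈-vectorsOfLength all∈ v)

signs : List Bool
signs = true ∷ false ∷ []

∈-signs : ∀ b → b ∈ₗ signs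
∈-signs true = here refl
∈-signs false = there (here refl)

literals : ∀ n → List (Literal n)
literals n = cartesianProductWith _,_ (allFin n) signs

length-literals : ∀ n → length (literals n) ≡ 2 * n
length-literals n = trans (length-cartesianProductWith _,_ (allFin n) signs)
                          (trans (cong (_* 2) (length-tabulate {n = n} (λ x → x))) (*-comm n 2))

∈-literals : ∀ {n} (l : Literal n) → l ∈ₗ literals n
∈-literals (x , b) = ∈-cartesianProductWith⁺ _,_ (∈-allFin x) (∈-signs b)

-- Occurrences, repeats and lonely positions

indicator : ∀ {P : Set} → Dec P → ℕ
indicator (yes _) = 1
indicator (no _) = 0

indicator-≟-refl : ∀ {n} (x : Fin n) → indicator (x ≟ᶠ x) ≡ 1
indicator-≟-refl x with x ≟ᶠ x
... | yes _ = refl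
... | no x≢x = contradiction refl x≢x

indicator-≟-sym : ∀ {n} (x y : Fin n) → indicator (x ≟ᶠ y) ≡ indicator (y ≟ᶠ x)
indicator-≟-sym x y with x ≟ᶠ y | y ≟ᶠ x
... | yes _ | yes _ = refl
... | no _ | no _ = refl
... | yes x≡y | no y≢x = contradiction (sym x≡y) y≢x
... | no x≢y | yes y≡x = contradiction (sym y≡x) x≢y

occurrences : ∀ {n} → Fin n → List (Literal n) → ℕ
occurrences x [] = 0
occurrences x (l ∷ ls) = indicator (var l ≟ᶠ x) + occurrences x ls

occurrences-++ : ∀ {n} (x : Fin n) ls ls′ → occurrences x (ls ++ ls′) ≡ occurrences x ls + occurrences x ls′
occurrences-++ x [] ls′ = refl
occurrences-++ x (l ∷ ls) ls′ =
  trans (cong (indicator (var l ≟ᶠ x) +_) (occurrences-++ x ls ls′)) (sym (+-assoc (indicator (var l ≟ᶠ x)) _ _))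

occurrences>0⇒∈ : ∀ {n} (x : Fin n) ls → 1 ≤ occurrences x ls → ∃[ l ] (l ∈ₗ ls × var l ≡ x)
occurrences>0⇒∈ x (l ∷ ls) 1≤occ with var l ≟ᶠ x
... | yes l∼x = l , here refl , l∼x
... | no _ with occurrences>0⇒∈ x ls 1≤occ
... | l′ , l′∈ , l′∼x = l′ , there l′∈ , l′∼x

fromBool : Bool → ℕ
fromBool true = 1
fromBool false = 0

isPositive : ℕ → Bool
isPositive zero = false
isPositive (suc _) = true

isOnce : ℕ → Bool
isOnce (suc zero) = true
isOnce _ = false

repeats : ∀ {n} → List (Literal n) → ℕ
repeats [] = 0
repeats (l ∷ ls) = fromBool (isPositive (occurrences (var l) ls)) + repeats ls

signed : ∀ {n} → Fin n → List (Literal n)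
signed x = map (x ,_) signs

∈-signed : ∀ {n} (l : Literal n) → l ∈ₗ signed (var l)
∈-signed (x , b) = ∈-map⁺ (x ,_) (∈-signs b)

repeatingHeads : ∀ {n} → List (Literal n) → List (List (Literal n))
repeatingHeads ls = concatMap (λ l → map (_∷ ls) (signed (var l))) ls

-- A sequence with a repeat at its head is fixed by its tail, a later position and a sign:
-- 2r choices instead of the 2n free literals.
withRepeats : ∀ {n} → ℕ → ℕ → List (List (Literal n))
withRepeats {n} r zero = listsOfLength r (literals n)
withRepeats zero (suc u) = []
withRepeats {n} (suc r) (suc u) =
  cartesianProductWith _∷_ (literals n) (withRepeats r (suc u)) ++ concatMap repeatingHeads (withRepeats r u)

∈-withRepeats⁻ : ∀ {n} r u {ls : List (Literal n)} → ls ∈ₗ withRepeats r u → length ls ≡ r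
∈-withRepeats⁻ {n} r zero ls∈ = ∈-listsOfLength⁻ r (literals n) ls∈
∈-withRepeats⁻ {n} (suc r) (suc u) ls∈ with ∈-++⁻ (cartesianProductWith _∷_ (literals n) (withRepeats r (suc u))) ls∈
... | inj₁ ls∈free with ∈-cartesianProductWith⁻ _∷_ (literals n) (withRepeats r (suc u)) ls∈free
...   | _ , tail , _ , tail∈ , refl = cong suc (∈-withRepeats⁻ r (suc u) tail∈)
∈-withRepeats⁻ {n} (suc r) (suc u) ls∈ | inj₂ ls∈repeating with ∈-concatMap⁻ repeatingHeads (withRepeats r u) ls∈repeating
... | tail , tail∈ , ls∈heads with ∈-concatMap⁻ _ tail ls∈heads
...   | l , _ , ls∈map with ∈-map⁻ (_∷ tail) ls∈map
...     | _ , _ , refl = cong suc (∈-withRepeats⁻ r u tail∈)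

∈-withRepeats⁺ : ∀ {n} u (ls : List (Literal n)) → u ≤ repeats ls → ls ∈ₗ withRepeats (length ls) u
∈-withRepeats⁺ zero ls _ = ∈-listsOfLength⁺ ∈-literals ls
∈-withRepeats⁺ {n} (suc u) (l ∷ ls) u<rep with occurrences (var l) ls in occ≡
... | zero = ∈-++⁺ˡ (∈-cartesianProductWith⁺ _∷_ (∈-literals l) (∈-withRepeats⁺ (suc u) ls u<rep))
... | suc _ with occurrences>0⇒∈ (var l) ls (subst (1 ≤_) (sym occ≡) (s≤s z≤n))
...   | l′ , l′∈ls , l′∼l = ∈-++⁺ʳ (cartesianProductWith _∷_ (literals n) (withRepeats (length ls) (suc u)))
          (∈-concatMap⁺ (∈-withRepeats⁺ u ls (≤-pred u<rep))
            (∈-concatMap⁺ l′∈ls (∈-map⁺ (_∷ ls) (subst (λ x → l ∈ₗ signed x) (sym l′∼l) (∈-signed l)))))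

length-withRepeats : ∀ {n} r u → length (withRepeats {n} r u) * (2 * n) ^ u ≤ 2 ^ r * (2 * r) ^ u * (2 * n) ^ r
length-withRepeats {n} r zero = begin
    length (listsOfLength r (literals n)) * 1   ≡⟨ *-identityʳ _ ⟩
    length (listsOfLength r (literals n))       ≡⟨ length-listsOfLength r (literals n) ⟩
    length (literals n) ^ r                     ≡⟨ cong (_^ r) (length-literals n) ⟩
    (2 * n) ^ r                                 ≤⟨ m≤n*m _ (2 ^ r * 1) {{subst NonZero (sym (*-identityʳ (2 ^ r))) (m^n≢0 2 r)}} ⟩
    2 ^ r * 1 * (2 * n) ^ r                     ∎
  where open ≤-Reasoning
length-withRepeats zero (suc u) = z≤n
length-withRepeats {n} (suc r) (suc u) = begin
    length (cartesianProductWith _∷_ (literals n) (withRepeats r (suc u)) ++ concatMap repeatingHeads (withRepeats r u)) * (A * A ^ u)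
  ≡⟨ cong (_* (A * A ^ u)) (length-++ (cartesianProductWith _∷_ (literals n) (withRepeats r (suc u)))) ⟩
    (length (cartesianProductWith _∷_ (literals n) (withRepeats r (suc u))) + length (concatMap repeatingHeads (withRepeats r u))) * (A * A ^ u)
  ≤⟨ *-monoˡ-≤ (A * A ^ u) (+-mono-≤ (≤-reflexive free) repeating) ⟩
    (A * G₁ + G₀ * (r * 2)) * (A * A ^ u)
  ≡⟨ distribute A G₁ G₀ r (A ^ u) ⟩
    A * (G₁ * (A * A ^ u)) + (r * 2) * A * (G₀ * A ^ u)
  ≤⟨ +-mono-≤ (*-monoʳ-≤ A (length-withRepeats r (suc u))) (*-monoʳ-≤ ((r * 2) * A) (length-withRepeats r u)) ⟩
    A * (2 ^ r * (2 * r) ^ suc u * A ^ r) + (r * 2) * A * (2 ^ r * (2 * r) ^ u * A ^ r)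
  ≡⟨ collect A (2 ^ r) r ((2 * r) ^ u) (A ^ r) ⟩
    2 * 2 ^ r * (2 * r) ^ suc u * (A * A ^ r)
  ≤⟨ *-monoˡ-≤ (A * A ^ r) (*-monoʳ-≤ (2 * 2 ^ r) (^-monoˡ-≤ (suc u) (*-monoʳ-≤ 2 (n≤1+n r)))) ⟩
    2 * 2 ^ r * (2 * suc r) ^ suc u * (A * A ^ r)
  ∎
  where
  open ≤-Reasoning
  A = 2 * n
  G₁ = length (withRepeats {n} r (suc u))
  G₀ = length (withRepeats {n} r u)
  free : length (cartesianProductWith _∷_ (literals n) (withRepeats r (suc u))) ≡ A * G₁
  free = trans (length-cartesianProductWith _∷_ (literals n) _) (cong (_* G₁) (length-literals n))
  repeating : length (concatMap repeatingHeads (withRepeats r u)) ≤ G₀ * (r * 2)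
  repeating = length-concatMap≤ repeatingHeads (withRepeats r u) (r * 2) (λ ls ls∈ →
                ≤-trans (length-concatMap≤ _ ls 2 (λ _ _ → ≤-refl)) (≤-reflexive (cong (_* 2) (∈-withRepeats⁻ r u ls∈))))
  distribute : ∀ A G₁ G₀ r p → (A * G₁ + G₀ * (r * 2)) * (A * p) ≡ A * (G₁ * (A * p)) + (r * 2) * A * (G₀ * p)
  distribute = solve-∀
  collect : ∀ A t r q a → A * (t * ((2 * r) * q) * a) + (r * 2) * A * (t * q * a) ≡ 2 * t * ((2 * r) * q) * (A * a)
  collect = solve-∀

once : ℕ → ℕ
once o = fromBool (isOnce o)

notOnce : ℕ → ℕ
notOnce o = fromBool (not (isOnce o))

lonely : ∀ {n} → List (Literal n) → List (Literal n) → ℕ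
lonely L ls = sum (map (λ l → once (occurrences (var l) L)) ls)

shared : ∀ {n} → List (Literal n) → List (Literal n) → ℕ
shared L ls = sum (map (λ l → notOnce (occurrences (var l) L)) ls)

shared+lonely≡length : ∀ {n} (L ls : List (Literal n)) → shared L ls + lonely L ls ≡ length ls
shared+lonely≡length L [] = refl
shared+lonely≡length L (l ∷ ls) =
  trans (interchange (notOnce o) (shared L ls) (once o) (lonely L ls))
        (cong₂ _+_ (not-b+b≡1 (isOnce o)) (shared+lonely≡length L ls))
  where
  o = occurrences (var l) L
  not-b+b≡1 : ∀ b → fromBool (not b) + fromBool b ≡ 1
  not-b+b≡1 true = refl
  not-b+b≡1 false = refl
  interchange : ∀ a b c d → a + b + (c + d) ≡ (a + c) + (b + d)
  interchange = solve-∀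

notOnce-∷ : ∀ {n} (x : Literal n) L (l : Literal n) →
            notOnce (occurrences (var l) (x ∷ L)) ≤
            notOnce (occurrences (var l) L) + indicator (var l ≟ᶠ var x) * once (occurrences (var x) L)
notOnce-∷ (a , _) L (c , _) with a ≟ᶠ c
... | no a≢c rewrite indicator-≟-sym c a with a ≟ᶠ c
...   | yes a≡c = contradiction a≡c a≢c
...   | no _ = m≤m+n _ _
notOnce-∷ (a , _) L (c , _) | yes refl rewrite indicator-≟-refl a with occurrences a L
... | zero = z≤n
... | suc zero = ≤-refl
... | suc (suc _) = s≤s z≤n

shared-∷ : ∀ {n} (x : Literal n) L ls →
           shared (x ∷ L) ls ≤ shared L ls + occurrences (var x) ls * once (occurrences (var x) L)
shared-∷ x L [] = z≤n
shared-∷ x L (l ∷ ls) = begin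
    notOnce (occurrences (var l) (x ∷ L)) + shared (x ∷ L) ls
  ≤⟨ +-mono-≤ (notOnce-∷ x L l) (shared-∷ x L ls) ⟩
    (notOnce (occurrences (var l) L) + δ * I) + (shared L ls + occurrences (var x) ls * I)
  ≡⟨ collect (notOnce (occurrences (var l) L)) δ I (shared L ls) (occurrences (var x) ls) ⟩
    shared L (l ∷ ls) + occurrences (var x) (l ∷ ls) * I
  ∎
  where
  open ≤-Reasoning
  δ = indicator (var l ≟ᶠ var x)
  I = once (occurrences (var x) L)
  collect : ∀ a d i b o → (a + d * i) + (b + o * i) ≡ (a + b) + (d + o) * i
  collect = solve-∀

-- A variable occurring c ≥ 2 times in L gives c shared positions but c - 1 repeats, and c ≤ 2(c - 1).
shared-self≤2*repeats : ∀ {n} (L : List (Literal n)) → shared L L ≤ 2 * repeats L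
shared-self≤2*repeats [] = z≤n
shared-self≤2*repeats (x ∷ L) = begin
    notOnce (occurrences (var x) (x ∷ L)) + shared (x ∷ L) L
  ≤⟨ +-mono-≤ (≤-reflexive (cong (λ d → notOnce (d + o)) (indicator-≟-refl (var x)))) (shared-∷ x L L) ⟩
    notOnce (suc o) + (shared L L + o * once o)
  ≤⟨ +-mono-≤ (notOnce-suc o) (+-mono-≤ (shared-self≤2*repeats L) (o*once-o o)) ⟩
    p + (2 * repeats L + p)
  ≡⟨ collect p (repeats L) ⟩
    2 * (p + repeats L)
  ∎
  where
  open ≤-Reasoning
  o = occurrences (var x) L
  p = fromBool (isPositive o)
  notOnce-suc : ∀ o → notOnce (suc o) ≤ fromBool (isPositive o)
  notOnce-suc zero = z≤n
  notOnce-suc (suc o) = ≤-refl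
  o*once-o : ∀ o → o * once o ≤ fromBool (isPositive o)
  o*once-o zero = z≤n
  o*once-o (suc zero) = ≤-refl
  o*once-o (suc (suc o)) = ≤-trans (≤-reflexive (*-zeroʳ (suc (suc o)))) z≤n
  collect : ∀ p r → p + (2 * r + p) ≡ 2 * (p + r)
  collect = solve-∀

-- The clauses indexed by a subset

module _ {A : Set} where

  selected : ∀ {m} → Subset m → Vec A m → List A
  selected [] [] = []
  selected (true ∷ Z) (a ∷ v) = a ∷ selected Z v
  selected (false ∷ Z) (a ∷ v) = selected Z v

  unselected : ∀ {m} → Subset m → Vec A m → List A
  unselected [] [] = []
  unselected (true ∷ Z) (a ∷ v) = unselected Z v
  unselected (false ∷ Z) (a ∷ v) = a ∷ unselected Z v

  length-selected : ∀ {m} (Z : Subset m) v → length (selected Z v) ≡ ∣ Z ∣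
  length-selected [] [] = refl
  length-selected (true ∷ Z) (a ∷ v) = cong suc (length-selected Z v)
  length-selected (false ∷ Z) (a ∷ v) = length-selected Z v

  length-unselected : ∀ {m} (Z : Subset m) v → length (unselected Z v) + ∣ Z ∣ ≡ m
  length-unselected [] [] = refl
  length-unselected (true ∷ Z) (a ∷ v) = trans (+-suc _ _) (cong suc (length-unselected Z v))
  length-unselected (false ∷ Z) (a ∷ v) = cong suc (length-unselected Z v)

  ∈-selected⁻ : ∀ {m} (Z : Subset m) v {a} → a ∈ₗ selected Z v → ∃[ c ] (c ∈ Z × lookup v c ≡ a)
  ∈-selected⁻ [] [] ()
  ∈-selected⁻ (true ∷ Z) (a ∷ v) (here refl) = zero , here , refl
  ∈-selected⁻ (true ∷ Z) (a ∷ v) (there a∈) with ∈-selected⁻ Z v a∈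
  ... | c , c∈Z , refl = suc c , there c∈Z , refl
  ∈-selected⁻ (false ∷ Z) (a ∷ v) a∈ with ∈-selected⁻ Z v a∈
  ... | c , c∈Z , refl = suc c , there c∈Z , refl

  -- The default d only fills entries for which the lists are too short.
  interleave : ∀ {m} → A → Subset m → List A → List A → Vec A m
  interleave d [] ys zs = []
  interleave d (true ∷ Z) [] zs = d ∷ interleave d Z [] zs
  interleave d (true ∷ Z) (y ∷ ys) zs = y ∷ interleave d Z ys zs
  interleave d (false ∷ Z) ys [] = d ∷ interleave d Z ys []
  interleave d (false ∷ Z) ys (z ∷ zs) = z ∷ interleave d Z ys zs

  interleave-selected-unselected : ∀ {m} d (Z : Subset m) v → interleave d Z (selected Z v) (unselected Z v) ≡ v
  interleave-selected-unselected d [] [] = refl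
  interleave-selected-unselected d (true ∷ Z) (a ∷ v) = cong (a ∷_) (interleave-selected-unselected d Z v)
  interleave-selected-unselected d (false ∷ Z) (a ∷ v) = cong (a ∷_) (interleave-selected-unselected d Z v)

  length-concatMap-toList : ∀ {k} (vs : List (Vec A k)) → length (concatMap toList vs) ≡ length vs * k
  length-concatMap-toList [] = refl
  length-concatMap-toList (v ∷ vs) =
    trans (length-++ (toList v)) (cong₂ _+_ (length-toList v) (length-concatMap-toList vs))

literalsIn : ∀ {n k m} → Subset m → Formula n k m → List (Literal n)
literalsIn Z Φ = concatMap toList (selected Z Φ)

clause : ∀ {n k m} → Formula n k m → Fin m → List (Literal n)
clause Φ c = toList (lookup Φ c)

occurrences-≤-literalsIn : ∀ {n k m} (Z : Subset m) (Φ : Formula n k m) {c} x → c ∈ Z →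
                           occurrences x (clause Φ c) ≤ occurrences x (literalsIn Z Φ)
occurrences-≤-literalsIn (true ∷ Z) (φ ∷ Φ) x here =
  ≤-trans (m≤m+n _ _) (≤-reflexive (sym (occurrences-++ x (toList φ) _)))
occurrences-≤-literalsIn (true ∷ Z) (φ ∷ Φ) x (there c∈Z) =
  ≤-trans (occurrences-≤-literalsIn Z Φ x c∈Z) (≤-trans (m≤n+m _ _) (≤-reflexive (sym (occurrences-++ x (toList φ) _))))
occurrences-≤-literalsIn (false ∷ Z) (φ ∷ Φ) x (there c∈Z) = occurrences-≤-literalsIn Z Φ x c∈Z

occurrences-+-≤-literalsIn : ∀ {n k m} (Z : Subset m) (Φ : Formula n k m) {c j} x → c ∈ Z → j ∈ Z → c ≢ j →
                             occurrences x (clause Φ c) + occurrences x (clause Φ j) ≤ occurrences x (literalsIn Z Φ)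
occurrences-+-≤-literalsIn (true ∷ Z) (φ ∷ Φ) x here here c≢j = contradiction refl c≢j
occurrences-+-≤-literalsIn (true ∷ Z) (φ ∷ Φ) x here (there j∈Z) c≢j =
  ≤-trans (+-monoʳ-≤ _ (occurrences-≤-literalsIn Z Φ x j∈Z)) (≤-reflexive (sym (occurrences-++ x (toList φ) _)))
occurrences-+-≤-literalsIn (true ∷ Z) (φ ∷ Φ) {suc c} x (there c∈Z) here c≢j =
  ≤-trans (≤-reflexive (+-comm (occurrences x (clause Φ c)) (occurrences x (toList φ))))
          (≤-trans (+-monoʳ-≤ _ (occurrences-≤-literalsIn Z Φ x c∈Z)) (≤-reflexive (sym (occurrences-++ x (toList φ) _))))
occurrences-+-≤-literalsIn (true ∷ Z) (φ ∷ Φ) x (there c∈Z) (there j∈Z) c≢j =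
  ≤-trans (occurrences-+-≤-literalsIn Z Φ x c∈Z j∈Z (c≢j ∘′ cong suc))
          (≤-trans (m≤n+m _ _) (≤-reflexive (sym (occurrences-++ x (toList φ) _))))
occurrences-+-≤-literalsIn (false ∷ Z) (φ ∷ Φ) x (there c∈Z) (there j∈Z) c≢j =
  occurrences-+-≤-literalsIn Z Φ x c∈Z j∈Z (c≢j ∘′ cong suc)

occurrences>0⇒lookup : ∀ {n k} (v : Vec (Literal n) k) x → 1 ≤ occurrences x (toList v) → ∃[ j ] var (lookup v j) ≡ x
occurrences>0⇒lookup (l ∷ v) x 1≤occ with var l ≟ᶠ x
... | yes l∼x = zero , l∼x
... | no _ with occurrences>0⇒lookup v x 1≤occ
... | j , lookup∼x = suc j , lookup∼x

occurrences-lookup>0 : ∀ {n k} (v : Vec (Literal n) k) j → 1 ≤ occurrences (var (lookup v j)) (toList v)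
occurrences-lookup>0 (l ∷ v) zero rewrite indicator-≟-refl (var l) = s≤s z≤n
occurrences-lookup>0 (l ∷ v) (suc j) = ≤-trans (occurrences-lookup>0 v j) (m≤n+m _ _)

-- Greedy matchings

∑-mono-≤ : ∀ {n} (f g : Fin n → ℕ) → (∀ x → f x ≤ g x) → ∑[ x < n ] f x ≤ ∑[ x < n ] g x
∑-mono-≤ {zero} f g f≤g = z≤n
∑-mono-≤ {suc n} f g f≤g = +-mono-≤ (f≤g zero) (∑-mono-≤ (f ∘′ suc) (g ∘′ suc) (λ x → f≤g (suc x)))

∑-indicator : ∀ {n} (g : Fin n → ℕ) a → ∑[ x < n ] (g x * indicator (a ≟ᶠ x)) ≡ g a
∑-indicator {suc n} g zero =
  trans (cong₂ _+_ (*-identityʳ (g zero))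
                   (trans (sum-cong-≗ (λ x → *-zeroʳ (g (suc x)))) (sum-replicate-zero n)))
        (+-identityʳ (g zero))
∑-indicator {suc n} g (suc a) =
  trans (cong₂ _+_ (*-zeroʳ (g zero)) (sum-cong-≗ (λ x → cong (g (suc x) *_) (indicator-suc a x))))
        (∑-indicator (g ∘′ suc) a)
  where
  indicator-suc : ∀ {n} (a b : Fin n) → indicator (suc a ≟ᶠ suc b) ≡ indicator (a ≟ᶠ b)
  indicator-suc a b with a ≟ᶠ b
  ... | yes _ = refl
  ... | no _ = refl

sum-over-positions≡sum-over-variables : ∀ {n} (g : Fin n → ℕ) (ls : List (Literal n)) →
  sum (map (g ∘′ var) ls) ≡ ∑[ x < n ] (g x * occurrences x ls)
sum-over-positions≡sum-over-variables {n} g [] =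
  sym (trans (sum-cong-≗ (λ x → *-zeroʳ (g x))) (sum-replicate-zero n))
sum-over-positions≡sum-over-variables {n} g (l ∷ ls) = sym (begin
    ∑[ x < n ] (g x * (indicator (var l ≟ᶠ x) + occurrences x ls))
  ≡⟨ sum-cong-≗ (λ x → *-distribˡ-+ (g x) (indicator (var l ≟ᶠ x)) (occurrences x ls)) ⟩
    ∑[ x < n ] (g x * indicator (var l ≟ᶠ x) + g x * occurrences x ls)
  ≡⟨ ∑-distrib-+ (λ x → g x * indicator (var l ≟ᶠ x)) (λ x → g x * occurrences x ls) ⟩
    ∑[ x < n ] (g x * indicator (var l ≟ᶠ x)) + ∑[ x < n ] (g x * occurrences x ls)
  ≡⟨ cong₂ _+_ (∑-indicator g (var l)) (sym (sum-over-positions≡sum-over-variables g ls)) ⟩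
    g (var l) + sum (map (g ∘′ var) ls)
  ∎)
  where open ≡-Reasoning

∣tabulate∣≡∑ : ∀ {n} (f : Fin n → Bool) → ∣ tabulate f ∣ ≡ ∑[ x < n ] fromBool (f x)
∣tabulate∣≡∑ {zero} f = refl
∣tabulate∣≡∑ {suc n} f with f zero
... | true = cong suc (∣tabulate∣≡∑ (f ∘′ suc))
... | false = ∣tabulate∣≡∑ (f ∘′ suc)

∃-⊆-of-size : ∀ {n} (V : Subset n) q → q ≤ ∣ V ∣ → ∃[ S ] (S ⊆ V × ∣ S ∣ ≡ q)
∃-⊆-of-size {n} V zero _ = ⊥ , (λ x∈⊥ → contradiction x∈⊥ ∉⊥) , ∣⊥∣≡0 n
∃-⊆-of-size (true ∷ V) (suc q) (s≤s q≤∣V∣) with ∃-⊆-of-size V q q≤∣V∣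
... | S , S⊆V , ∣S∣≡q = true ∷ S , extend , cong suc ∣S∣≡q
  where
  extend : true ∷ S ⊆ true ∷ V
  extend here = here
  extend (there x∈S) = there (S⊆V x∈S)
∃-⊆-of-size (false ∷ V) (suc q) q<∣V∣ with ∃-⊆-of-size V (suc q) q<∣V∣
... | S , S⊆V , ∣S∣≡q = false ∷ S , extend , ∣S∣≡q
  where
  extend : false ∷ S ⊆ false ∷ V
  extend (there x∈S) = there (S⊆V x∈S)

module _ {n k m} (Φ : Formula n k m) where

  lonelyIn : Subset m → Fin m → ℕ
  lonelyIn Z c = lonely (literalsIn Z Φ) (clause Φ c)

  lonelyVariables : Subset m → Fin m → Subset n
  lonelyVariables Z c =
    tabulate (λ x → isOnce (occurrences x (literalsIn Z Φ)) ∧ isPositive (occurrences x (clause Φ c)))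

  ∈-lonelyVariables⁻ : ∀ {Z c x} → x ∈ lonelyVariables Z c →
                       occurrences x (literalsIn Z Φ) ≡ 1 × 1 ≤ occurrences x (clause Φ c)
  ∈-lonelyVariables⁻ {Z} {c} {x} x∈ =
    split (occurrences x (literalsIn Z Φ)) (occurrences x (clause Φ c)) (trans (sym (lookup∘tabulate _ x)) ([]=⇒lookup x∈))
    where
    split : ∀ a b → isOnce a ∧ isPositive b ≡ true → a ≡ 1 × 1 ≤ b
    split (suc zero) (suc b) _ = refl , s≤s z≤n

  -- A clause of Z has at most one position on each of its variables that are lonely in Φ_Z.
  lonelyIn≤∣lonelyVariables∣ : ∀ {Z c} → c ∈ Z → lonelyIn Z c ≤ ∣ lonelyVariables Z c ∣
  lonelyIn≤∣lonelyVariables∣ {Z} {c} c∈Z = begin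
      lonely L (clause Φ c)
    ≡⟨ sum-over-positions≡sum-over-variables (once ∘′ occL) (clause Φ c) ⟩
      ∑[ x < n ] (once (occL x) * occC x)
    ≤⟨ ∑-mono-≤ _ _ (λ x → pointwise (occL x) (occC x) (occurrences-≤-literalsIn Z Φ x c∈Z)) ⟩
      ∑[ x < n ] fromBool (isOnce (occL x) ∧ isPositive (occC x))
    ≡⟨ sym (∣tabulate∣≡∑ (λ x → isOnce (occL x) ∧ isPositive (occC x))) ⟩
      ∣ lonelyVariables Z c ∣
    ∎
    where
    open ≤-Reasoning
    L = literalsIn Z Φ
    occL = λ x → occurrences x L
    occC = λ x → occurrences x (clause Φ c)
    pointwise : ∀ a b → b ≤ a → once a * b ≤ fromBool (isOnce a ∧ isPositive b)
    pointwise zero b _ = z≤n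
    pointwise (suc zero) zero _ = z≤n
    pointwise (suc zero) (suc zero) _ = ≤-refl
    pointwise (suc zero) (suc (suc b)) (s≤s ())
    pointwise (suc (suc a)) b _ = z≤n

  module _ (q : ℕ) where

    emptyMatching : ∀ {Z} → Empty Z → HasMatching Φ Z q
    emptyMatching empty = (λ _ → ⊥)
                        , (λ _ _ x∈⊥ → contradiction x∈⊥ ∉⊥)
                        , (λ _ _ → refl)
                        , (λ i i∈Z → contradiction (i , i∈Z) empty)
                        , (λ _ _ _ x∈⊥ → contradiction x∈⊥ ∉⊥)

    -- Clause c takes q of its variables that are lonely in Φ_Z; no other clause of Z contains them.
    extendMatching : ∀ {Z c} → c ∈ Z → q ≤ lonelyIn Z c → HasMatching Φ (Z - c) q → HasMatching Φ Z q
    extendMatching {Z} {c} c∈Z q≤lonely (M′ , edges′ , outside′ , size′ , disjoint′) =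
      M , edges , outside , size , disjoint
      where
      chosen = ∃-⊆-of-size (lonelyVariables Z c) q (≤-trans q≤lonely (lonelyIn≤∣lonelyVariables∣ c∈Z))
      S = proj₁ chosen
      S⊆lonely = proj₁ (proj₂ chosen)
      M : Fin m → Subset n
      M i with i ≟ᶠ c
      ... | yes _ = S
      ... | no _ = M′ i
      edges : ∀ i x → x ∈ M i → Occurs Φ i x
      edges i x x∈ with i ≟ᶠ c
      ... | no _ = edges′ i x x∈
      ... | yes refl = occurrences>0⇒lookup (lookup Φ c) x (proj₂ (∈-lonelyVariables⁻ {Z} {c} (S⊆lonely x∈)))
      outside : ∀ i → i ∉ Z → M i ≡ ⊥
      outside i i∉Z with i ≟ᶠ c
      ... | yes refl = contradiction c∈Z i∉Z
      ... | no _ = outside′ i (i∉Z ∘′ p─q⊆p Z ⁅ c ⁆)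
      size : ∀ i → i ∈ Z → ∣ M i ∣ ≡ q
      size i i∈Z with i ≟ᶠ c
      ... | yes refl = proj₂ (proj₂ chosen)
      ... | no i≢c = size′ i (x∈p∧x≢y⇒x∈p-y i∈Z i≢c)
      clash : ∀ j x → j ≢ c → x ∈ S → ¬ (x ∈ M′ j)
      clash j x j≢c x∈S x∈M′j with j ∈? (Z - c)
      ... | no j∉Z-c = ∉⊥ (subst (x ∈_) (outside′ j j∉Z-c) x∈M′j)
      ... | yes j∈Z-c = contradiction twice λ { (s≤s ()) }
        where
        lonelyVar = ∈-lonelyVariables⁻ {Z} {c} (S⊆lonely x∈S)
        inClause-j = edges′ j x x∈M′j
        twice : 2 ≤ 1
        twice = begin
            2
          ≤⟨ +-mono-≤ (proj₂ lonelyVar)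
                      (subst (λ y → 1 ≤ occurrences y (clause Φ j)) (proj₂ inClause-j)
                             (occurrences-lookup>0 (lookup Φ j) (proj₁ inClause-j))) ⟩
            occurrences x (clause Φ c) + occurrences x (clause Φ j)
          ≤⟨ occurrences-+-≤-literalsIn Z Φ x c∈Z (p─q⊆p Z ⁅ c ⁆ j∈Z-c) (j≢c ∘′ sym) ⟩
            occurrences x (literalsIn Z Φ)
          ≡⟨ proj₁ lonelyVar ⟩
            1
          ∎
          where open ≤-Reasoning
      disjoint : ∀ i j x → x ∈ M i → x ∈ M j → i ≡ j
      disjoint i j x x∈Mi x∈Mj with i ≟ᶠ c | j ≟ᶠ c
      ... | yes refl | yes refl = refl
      ... | no _ | no _ = disjoint′ i j x x∈Mi x∈Mj
      ... | yes refl | no j≢c = contradiction x∈Mj (clash j x j≢c x∈Mi)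
      ... | no i≢c | yes refl = contradiction x∈Mi (clash i x i≢c x∈Mj)

    Unstuck : Set
    Unstuck = ∀ Z → Nonempty Z → ∣ Z ∣ * (k * k) ≤ n → ∃[ c ] (c ∈ Z × q ≤ lonelyIn Z c)

    greedyMatching : Unstuck → ∀ t Z → ∣ Z ∣ ≤ t → ∣ Z ∣ * (k * k) ≤ n → HasMatching Φ Z q
    greedyMatching unstuck zero Z ∣Z∣≤0 small =
      emptyMatching (λ (c , c∈Z) → contradiction (≤-trans (x∈p⇒∣p-x∣<∣p∣ c∈Z) ∣Z∣≤0) λ ())
    greedyMatching unstuck (suc t) Z ∣Z∣≤1+t small with nonempty? Z
    ... | no empty = emptyMatching empty
    ... | yes nonempty with unstuck Z nonempty small
    ...   | c , c∈Z , q≤lonely = extendMatching c∈Z q≤lonely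
              (greedyMatching unstuck t (Z - c) (≤-pred (≤-trans smaller ∣Z∣≤1+t))
                              (≤-trans (*-monoˡ-≤ (k * k) (<⇒≤ smaller)) small))
      where
      smaller : ∣ Z - c ∣ < ∣ Z ∣
      smaller = x∈p⇒∣p-x∣<∣p∣ c∈Z

    Stuck : Subset m → Set
    Stuck Z = Nonempty Z × ∣ Z ∣ * (k * k) ≤ n × (∀ c → c ∈ Z → lonelyIn Z c < q)

    stuck? : ∀ Z → Dec (Stuck Z)
    stuck? Z = nonempty? Z ×-dec (∣ Z ∣ * (k * k) ≤? n) ×-dec all? (λ c → (c ∈? Z) →-dec (lonelyIn Z c <? q))

    unstuck : ¬ (∃[ Z ] Stuck Z) → Unstuck
    unstuck never-stuck Z nonempty small
      with ¬∀⟶∃¬ m _ (λ c → (c ∈? Z) →-dec (lonelyIn Z c <? q)) (λ all-few → never-stuck (Z , nonempty , small , all-few))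
    ... | c , not-few with c ∈? Z
    ...   | no c∉Z = contradiction (λ c∈Z → contradiction c∈Z c∉Z) not-few
    ...   | yes c∈Z = c , c∈Z , ≮⇒≥ (λ few → not-few (λ _ → few))

    ¬stuck⇒matchings : ¬ (∃[ Z ] Stuck Z) → ∀ Z → ∣ Z ∣ * (k * k) ≤ n → HasMatching Φ Z q
    ¬stuck⇒matchings never-stuck Z small = greedyMatching (unstuck never-stuck) ∣ Z ∣ Z ≤-refl small

    stuck⇒repeats : ∀ {Z} w → 2 * w + q ≤ k → Stuck Z → ∣ Z ∣ * w ≤ repeats (literalsIn Z Φ)
    stuck⇒repeats {Z} w 2w+q≤k (_ , _ , few) = *-cancelˡ-≤ 2 (begin
        2 * (∣ Z ∣ * w)                                      ≡⟨ x∙yz≈y∙xz 2 (∣ Z ∣) w ⟩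
        ∣ Z ∣ * (2 * w)                                      ≡⟨ cong (_* (2 * w)) (sym (length-selected Z Φ)) ⟩
        length (selected Z Φ) * (2 * w)                      ≤⟨ *-length≤sum-map sharedIn (2 * w) (selected Z Φ) per-clause ⟩
        sum (map sharedIn (selected Z Φ))                   ≡⟨ sym (sum-map-concatMap (λ l → notOnce (occurrences (var l) L)) toList (selected Z Φ)) ⟩
        shared L L                                           ≤⟨ shared-self≤2*repeats L ⟩
        2 * repeats L                                        ∎)
      where
      open ≤-Reasoning
      L = literalsIn Z Φ
      sharedIn : Vec (Literal n) k → ℕ
      sharedIn φ = shared L (toList φ)
      x∙yz≈y∙xz : ∀ a b c → a * (b * c) ≡ b * (a * c)
      x∙yz≈y∙xz = solve-∀
      per-clause : ∀ φ → φ ∈ₗ selected Z Φ → 2 * w ≤ shared L (toList φ)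
      per-clause φ φ∈ with ∈-selected⁻ Z Φ φ∈
      ... | c , c∈Z , refl = +-cancelʳ-≤ q (2 * w) (shared L (clause Φ c)) (begin
          2 * w + q                                          ≤⟨ 2w+q≤k ⟩
          k                                                  ≡⟨ sym (trans (shared+lonely≡length L (clause Φ c)) (length-toList (lookup Φ c))) ⟩
          shared L (clause Φ c) + lonelyIn Z c               ≤⟨ +-monoʳ-≤ _ (<⇒≤ (few c c∈Z)) ⟩
          shared L (clause Φ c) + q                          ∎)

-- Counting formulas with a stuck subset

subsetsOfSize : ∀ m → ℕ → List (Subset m)
subsetsOfSize zero zero = [] ∷ []
subsetsOfSize zero (suc s) = []
subsetsOfSize (suc m) zero = map (false ∷_) (subsetsOfSize m zero)
subsetsOfSize (suc m) (suc s) = map (false ∷_) (subsetsOfSize m (suc s)) ++ map (true ∷_) (subsetsOfSize m s)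

length-subsetsOfSize : ∀ m s → length (subsetsOfSize m s) ≡ m C s
length-subsetsOfSize zero zero = refl
length-subsetsOfSize zero (suc s) = refl
length-subsetsOfSize (suc m) zero = trans (length-map _ (subsetsOfSize m zero)) (length-subsetsOfSize m zero)
length-subsetsOfSize (suc m) (suc s) = begin
    length (map (false ∷_) (subsetsOfSize m (suc s)) ++ map (true ∷_) (subsetsOfSize m s))
  ≡⟨ length-++ (map (false ∷_) (subsetsOfSize m (suc s))) ⟩
    length (map (false ∷_) (subsetsOfSize m (suc s))) + length (map (true ∷_) (subsetsOfSize m s))
  ≡⟨ cong₂ _+_ (trans (length-map _ (subsetsOfSize m (suc s))) (length-subsetsOfSize m (suc s)))
               (trans (length-map _ (subsetsOfSize m s)) (length-subsetsOfSize m s)) ⟩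
    m C suc s + m C s
  ≡⟨ +-comm (m C suc s) (m C s) ⟩
    m C s + m C suc s
  ≡⟨ nCk+nC[k+1]≡[n+1]C[k+1] m s ⟩
    suc m C suc s
  ∎
  where open ≡-Reasoning

∈-subsetsOfSize : ∀ {m} (Z : Subset m) → Z ∈ₗ subsetsOfSize m ∣ Z ∣
∈-subsetsOfSize [] = here refl
∈-subsetsOfSize (true ∷ Z) = ∈-++⁺ʳ (map (false ∷_) (subsetsOfSize _ (suc ∣ Z ∣))) (∈-map⁺ (true ∷_) (∈-subsetsOfSize Z))
∈-subsetsOfSize (false ∷ Z) with ∣ Z ∣ | ∈-subsetsOfSize Z
... | zero | Z∈ = ∈-map⁺ (false ∷_) Z∈
... | suc _ | Z∈ = ∈-++⁺ˡ (∈-map⁺ (false ∷_) Z∈)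

module _ {A : Set} where

  takeVec : ∀ k → A → List A → Vec A k × List A
  takeVec zero d as = [] , as
  takeVec (suc k) d [] = d ∷ proj₁ (takeVec k d []) , []
  takeVec (suc k) d (a ∷ as) = a ∷ proj₁ (takeVec k d as) , proj₂ (takeVec k d as)

  takeVec-toList-++ : ∀ {k} d (v : Vec A k) as → takeVec k d (toList v ++ as) ≡ (v , as)
  takeVec-toList-++ d [] as = refl
  takeVec-toList-++ d (a ∷ v) as rewrite takeVec-toList-++ d v as = refl

  unconcat : ∀ k → A → ℕ → List A → List (Vec A k)
  unconcat k d zero as = []
  unconcat k d (suc s) as = proj₁ (takeVec k d as) ∷ unconcat k d s (proj₂ (takeVec k d as))

  unconcat-concatMap-toList : ∀ {k} d (vs : List (Vec A k)) → unconcat k d (length vs) (concatMap toList vs) ≡ vs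
  unconcat-concatMap-toList d [] = refl
  unconcat-concatMap-toList d (v ∷ vs) rewrite takeVec-toList-++ d v (concatMap toList vs) =
    cong (v ∷_) (unconcat-concatMap-toList d vs)

-- A formula with a stuck set Z of size s is determined by Z, the sequence of literals of Φ_Z
-- (which has at least s w repeats) and the clauses outside Z; d is a padding literal.
module Candidates (n k m v : ℕ) (d : Literal n) where

  w : ℕ
  w = v + 3

  clauses : List (Vec (Literal n) k)
  clauses = vectorsOfLength k (literals n)

  assemble : ℕ → Subset m → List (Literal n) → List (Vec (Literal n) k) → Formula n k m
  assemble s Z ls rest = interleave (replicate k d) Z (unconcat k d s ls) rest

  onSubset : ℕ → Subset m → List (Formula n k m)
  onSubset s Z = cartesianProductWith (assemble s Z) (withRepeats (s * k) (s * w)) (listsOfLength (m ∸ s) clauses)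

  ofSize : ℕ → List (Formula n k m)
  ofSize s = concatMap (onSubset s) (subsetsOfSize m s)

  Admissible : ℕ → Set
  Admissible s = 1 ≤ s × s * (k * k) ≤ n

  admissible? : ∀ s → Dec (Admissible s)
  admissible? s = 1 ≤? s ×-dec s * (k * k) ≤? n

  sizes : List ℕ
  sizes = filter admissible? (upTo (suc n))

  candidates : List (Formula n k m)
  candidates = concatMap ofSize sizes

  ∈-candidates : ∀ (Φ : Formula n k m) q {Z} → 1 ≤ k → 2 * w + q ≤ k → Stuck Φ q Z → Φ ∈ₗ candidates
  ∈-candidates Φ q {Z} 1≤k 2w+q≤k stuck@((c , c∈Z) , small , _) =
    ∈-concatMap⁺ {f = ofSize} (∈-filter⁺ admissible? (∈-upTo⁺ (s≤s s≤n)) (1≤s , small))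
      (∈-concatMap⁺ {f = onSubset s} (∈-subsetsOfSize Z) (subst (_∈ₗ onSubset s Z) assembled
        (∈-cartesianProductWith⁺ (assemble s Z) literals∈ rest∈)))
    where
    s = ∣ Z ∣
    L = literalsIn Z Φ
    1≤s : 1 ≤ s
    1≤s = ≤-trans (s≤s z≤n) (x∈p⇒∣p-x∣<∣p∣ c∈Z)
    s≤n : s ≤ n
    s≤n = ≤-trans (m≤m*n s (k * k) {{>-nonZero (*-mono-≤ 1≤k 1≤k)}}) small
    length-L : length L ≡ s * k
    length-L = trans (length-concatMap-toList (selected Z Φ)) (cong (_* k) (length-selected Z Φ))
    literals∈ : L ∈ₗ withRepeats (s * k) (s * w)
    literals∈ = subst (λ r → L ∈ₗ withRepeats r (s * w)) length-L
                      (∈-withRepeats⁺ (s * w) L (stuck⇒repeats Φ q w 2w+q≤k stuck))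
    length-rest : length (unselected Z Φ) ≡ m ∸ s
    length-rest = trans (sym (m+n∸n≡m (length (unselected Z Φ)) s)) (cong (_∸ s) (length-unselected Z Φ))
    rest∈ : unselected Z Φ ∈ₗ listsOfLength (m ∸ s) clauses
    rest∈ = subst (λ r → unselected Z Φ ∈ₗ listsOfLength r clauses) length-rest
                  (∈-listsOfLength⁺ (∈-vectorsOfLength ∈-literals) (unselected Z Φ))
    assembled : assemble s Z L (unselected Z Φ) ≡ Φ
    assembled = trans (cong (λ cs → interleave (replicate k d) Z cs (unselected Z Φ))
                            (trans (cong (λ t → unconcat k d t L) (sym (length-selected Z Φ)))
                                   (unconcat-concatMap-toList d (selected Z Φ))))
                      (interleave-selected-unselected (replicate k d) Z Φ)

  length-ofSize : ∀ s → Admissible s → m ≤ n * 2 ^ k → 4 ≤ k * k → 1 ≤ k →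
                  4 ^ suc k * k ^ (v + 3) ≤ k ^ v * k ^ v → length (ofSize s) * (n * n) ≤ (2 * n) ^ (k * m)
  length-ofSize s@(suc t) (_ , small) m≤n2^k 4≤k² 1≤k 4^[1+k]k^w≤k^2v = begin
      length (ofSize s) * (n * n)
    ≤⟨ *-monoˡ-≤ (n * n) (length-concatMap≤ (onSubset s) (subsetsOfSize m s) (G * R) (λ Z _ → ≤-reflexive (length-onSubset Z))) ⟩
      length (subsetsOfSize m s) * (G * R) * (n * n)
    ≡⟨ cong (λ z → z * (G * R) * (n * n)) (length-subsetsOfSize m s) ⟩
      (m C s) * (G * R) * (n * n)
    ≤⟨ bound (s ≤? m) ⟩
      (2 * n) ^ (k * m)
    ∎
    where
    open ≤-Reasoning
    G = length (withRepeats {n} (s * k) (s * w))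
    R = ((2 * n) ^ k) ^ (m ∸ s)
    length-onSubset : ∀ Z → length (onSubset s Z) ≡ G * R
    length-onSubset Z = trans (length-cartesianProductWith (assemble s Z) (withRepeats (s * k) (s * w)) _)
                              (cong (G *_) (trans (length-listsOfLength (m ∸ s) clauses)
                                (cong (_^ (m ∸ s)) (trans (length-vectorsOfLength k (literals n))
                                                          (cong (_^ k) (length-literals n))))))
    4s≤n : 4 * s ≤ n
    4s≤n = ≤-trans (≤-trans (*-monoˡ-≤ s 4≤k²) (≤-reflexive (*-comm (k * k) s))) small
    bound : Dec (s ≤ m) → (m C s) * (G * R) * (n * n) ≤ (2 * n) ^ (k * m)
    bound (no s≰m) rewrite k>n⇒nCk≡0 (≰⇒> s≰m) = z≤n
    bound (yes s≤m) = begin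
        (m C s) * (G * R) * (n * n)
      ≡⟨ regroup (m C s) G R (n * n) ⟩
        (m C s) * G * (n * n) * R
      ≤⟨ *-monoˡ-≤ R ([mCs]*G*n²≤[2n]^[sk] m n k v t G m≤n2^k small 4s≤n 1≤k 4^[1+k]k^w≤k^2v
                                                (length-withRepeats (s * k) (s * w))) ⟩
        (2 * n) ^ (s * k) * R
      ≡⟨ cong ((2 * n) ^ (s * k) *_) (^-*-assoc (2 * n) k (m ∸ s)) ⟩
        (2 * n) ^ (s * k) * (2 * n) ^ (k * (m ∸ s))
      ≡⟨ sym (^-distribˡ-+-* (2 * n) (s * k) (k * (m ∸ s))) ⟩
        (2 * n) ^ (s * k + k * (m ∸ s))
      ≡⟨ cong ((2 * n) ^_) (trans (cong (_+ k * (m ∸ s)) (*-comm s k))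
                           (trans (sym (*-distribˡ-+ k s (m ∸ s))) (cong (k *_) (m+[n∸m]≡n s≤m)))) ⟩
        (2 * n) ^ (k * m)
      ∎
      where
      regroup : ∀ b g c nn → b * (g * c) * nn ≡ b * g * nn * c
      regroup = solve-∀

  length-candidates : m ≤ n * 2 ^ k → 4 ≤ k * k → 1 ≤ k → 4 ^ suc k * k ^ (v + 3) ≤ k ^ v * k ^ v →
                      length candidates * (n * n) ≤ suc n * (2 * n) ^ (k * m)
  length-candidates m≤n2^k 4≤k² 1≤k 4^[1+k]k^w≤k^2v = begin
      length candidates * (n * n)
    ≤⟨ *-length-concatMap≤ ofSize sizes (n * n) ((2 * n) ^ (k * m)) (λ s s∈ →
         length-ofSize s (proj₂ (∈-filter⁻ admissible? {xs = upTo (suc n)} s∈)) m≤n2^k 4≤k² 1≤k 4^[1+k]k^w≤k^2v) ⟩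
      length sizes * (2 * n) ^ (k * m)
    ≤⟨ *-monoˡ-≤ ((2 * n) ^ (k * m)) (≤-trans (length-filter admissible? (upTo (suc n))) (≤-reflexive (length-upTo (suc n)))) ⟩
      suc n * (2 * n) ^ (k * m)
    ∎
    where open ≤-Reasoning

-- The first approximation lnPartial 0 + lnTail 0 of ln 2 is already 1.
AtMostTimesLn2⇒≤ : ∀ a b → AtMostTimesLn2 a b → a ≤ b
AtMostTimesLn2⇒≤ a b a≤b·ln2 with a≤b·ln2 0
... | *≤* a≤b = ℤ.drop‿+≤+ (subst₂ ℤ._≤_ (ℤ.*-identityʳ (ℤ.+ a))
                                     (trans (ℤ.*-identityʳ _) (ℤ.*-identityʳ (ℤ.+ b))) a≤b)

badProbAtMost : ∀ {k} → K₀ ≤ k → ∀ n′ m → m ≤ suc n′ * 2 ^ k → ∀ j → j + 2 ≤ suc n′ →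
                BadProbAtMost (suc n′) k m j
badProbAtMost {k} K₀≤k n′ m m≤n2^k j j+2≤n = C.candidates , few-candidates , classify
  where
  n = suc n′
  v = k / 20 ∸ 3
  q = ceil09 k
  module C = Candidates n k m v (zero , true)
  1≤k : 1 ≤ k
  1≤k = ≤-trans (≤ᵇ⇒≤ 1 K₀ _) K₀≤k
  4≤k² : 4 ≤ k * k
  4≤k² = *-mono-≤ {2} {k} {2} {k} 2≤k 2≤k
    where
    2≤k = ≤-trans (≤ᵇ⇒≤ 2 K₀ _) K₀≤k
  2w+q≤k : 2 * (v + 3) + q ≤ k
  2w+q≤k = subst (λ w → 2 * w + q ≤ k) (sym (m∸n+n≡m (≤-trans (≤ᵇ⇒≤ 3 20 _) (20≤k/20 K₀≤k))))
                 (2*[k/20]+⌈0∙9k⌉≤k k)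
  classify : (Φ : Formula n k m) → Good Φ ⊎ Φ ∈ₗ C.candidates
  classify Φ with anySubset? (stuck? Φ q)
  ... | yes (Z , stuck) = inj₂ (C.∈-candidates Φ q 1≤k 2w+q≤k stuck)
  ... | no never-stuck = inj₁ (¬stuck⇒matchings Φ q never-stuck)
  X = (2 * n) ^ (k * m)
  few-candidates : length C.candidates * suc j ≤ X
  few-candidates = *-cancelʳ-≤ _ _ (n * n) (begin
      length C.candidates * suc j * (n * n)    ≡⟨ x∙y∙z≈y∙[x∙z] (length C.candidates) (suc j) (n * n) ⟩
      suc j * (length C.candidates * (n * n))  ≤⟨ *-monoʳ-≤ (suc j) (C.length-candidates m≤n2^k 4≤k² 1≤k (4^[1+k]*k^[v+3]≤k^v*k^v K₀≤k)) ⟩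
      suc j * (suc n * X)                      ≡⟨ *-assoc (suc j) (suc n) X ⟨
      suc j * suc n * X                        ≤⟨ *-monoˡ-≤ X ([1+j]*[1+n]≤n*n j n j+2≤n) ⟩
      n * n * X                                ≡⟨ *-comm (n * n) X ⟩
      X * (n * n)                              ∎)
    where
    open ≤-Reasoning
    x∙y∙z≈y∙[x∙z] : ∀ a b c → a * b * c ≡ b * (a * c)
    x∙y∙z≈y∙[x∙z] = solve-∀

lemma3 : Σ ℕ λ k₀ → 0 < k₀ ×
           ((k : ℕ) → k₀ ≤ k →
            (m : ℕ → ℕ) → ((n : ℕ) → AtMostTimesLn2 (m n) (n * 2 ^ k)) →
            (j : ℕ) → Σ ℕ λ N → (n : ℕ) → N ≤ n → BadProbAtMost n k (m n) j)
lemma3 = K₀ , ≤ᵇ⇒≤ 1 K₀ _ , λ k K₀≤k m m≤n·2^k·ln2 j → j + 2 , λ where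
  zero j+2≤0 → contradiction (m+n≤o⇒n≤o j j+2≤0) λ ()
  (suc n′) j+2≤n → badProbAtMost K₀≤k n′ (m (suc n′)) (AtMostTimesLn2⇒≤ _ _ (m≤n·2^k·ln2 (suc n′))) j j+2≤n
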